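{- Let $G$ be a finite simple graph, with $(H,H')$, $M$, $M_A$, $H_A$ as in the standing setting below. Then $|H'| = |P_o^{H'}(M_A,H')| + |H_A| + \nu(G)-\alpha_2(G)$.
   Context: $\nu(G)$ is the maximum matching size. $B_2(G)$ is the set of pairs $(H,H')$ of edge-disjoint matchings; $\lambda_2(G)=\max\{|H|+|H'|:(H,H')\in B_2(G)\}$; $\alpha_2(G)=\max\{|H|,|H'|:(H,H')\in B_2(G),\ |H|+|H'|=\lambda_2(G)\}$; $M_2(G)=\{(H,H')\in B_2(G): |H|+|H'|=\lambda_2(G),\ |H|=\alpha_2(G)\}$. For matchings $A,B$: a path or even cycle $e_1,\dots,e_l$ ($l\ge1$) is $A$-$B$ alternating if the edges with odd indices lie in $A\setminus B$ and the others in $B\setminus A$, or vice versa; an alternating path is maximal if it is not a proper subpath of another $A$-$B$ alternating path. $P_o^A(A,B)$ (resp. $P_o^B(A,B)$) is the set of maximal $A$-$B$ alternating paths of odd length whose first edge is in $A$ (resp. $B$). Standing setting: over all $(H,H')\in M_2(G)$ and all maximum matchings $M$ of $G$, consider the triples maximizing $|M\cap H|$; among these, $((H,H'),M)$ is chosen to maximize $|M\cap H'|$. $M_A$ (resp. $H_A$) is the set of edges lying on paths of $P_o^M(M,H)$ that belong to $M$ (resp. $H$). -}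

module Defs where

open import Data.Nat using (ℕ; zero; suc; _+_; _*_; _∸_; _≤_; _<_; _<ᵇ_)
open import Data.Fin using (Fin; toℕ)
open import Data.Bool using (Bool; true; false; _∧_; if_then_else_)
open import Data.List using (List; []; _∷_; _++_; length; map; concatMap; reverse; allFin)
open import Data.Nat.ListAction using (sum)
open import Data.Product using (Σ; ∃; ∃₂; _×_; _,_)
open import Data.Sum using (_⊎_)
open import Relation.Nullary using (¬_)
open import Relation.Binary.PropositionalEquality using (_≡_)
open import Data.List.Relation.Unary.Unique.Propositional using (Unique)
open import Data.List.Membership.Propositional using (_∈_)

record SimpleGraph (n : ℕ) : Set where
  field
    adj        : Fin n → Fin n → Bool
    adj-sym    : ∀ i j → adj i j ≡ adj j i
    adj-irrefl : ∀ i → adj i i ≡ false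
open SimpleGraph public

-- A set of (unordered) edges: S i j ≡ true means {i,j} ∈ S.
-- (Symmetry is imposed where needed, see IsEdgeSetOf.)
EdgeSet : ℕ → Set
EdgeSet n = Fin n → Fin n → Bool

IsEdgeSetOf : ∀ {n} → SimpleGraph n → EdgeSet n → Set
IsEdgeSetOf G S = (∀ i j → S i j ≡ S j i) × (∀ i j → S i j ≡ true → adj G i j ≡ true)

pairs : (n : ℕ) → List (Fin n × Fin n)
pairs n = concatMap (λ i → map (λ j → (i , j)) (allFin n)) (allFin n)

-- |S| : number of unordered edges {i,j} (counted once, via i < j)
size : ∀ {n} → EdgeSet n → ℕ
size {n} S = sum (map (λ { (i , j) → if (toℕ i <ᵇ toℕ j) ∧ S i j then 1 else 0 }) (pairs n))

_∩_ : ∀ {n} → EdgeSet n → EdgeSet n → EdgeSet n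
(S ∩ T) i j = S i j ∧ T i j

IsMatching : ∀ {n} → SimpleGraph n → EdgeSet n → Set
IsMatching G S = IsEdgeSetOf G S × (∀ i j k → S i j ≡ true → S i k ≡ true → j ≡ k)

EdgeDisjoint : ∀ {n} → EdgeSet n → EdgeSet n → Set
EdgeDisjoint S T = ∀ i j → S i j ≡ true → T i j ≡ false

IsMaxMatching : ∀ {n} → SimpleGraph n → EdgeSet n → Set
IsMaxMatching G M = IsMatching G M × (∀ M' → IsMatching G M' → size M' ≤ size M)

IsNu : ∀ {n} → SimpleGraph n → ℕ → Set
IsNu G k = Σ _ λ M → IsMaxMatching G M × size M ≡ k

B2 : ∀ {n} → SimpleGraph n → EdgeSet n → EdgeSet n → Set
B2 G H H' = IsMatching G H × IsMatching G H' × EdgeDisjoint H H'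

IsLambda2 : ∀ {n} → SimpleGraph n → ℕ → Set
IsLambda2 G l =
  (∃₂ λ H H' → B2 G H H' × size H + size H' ≡ l) ×
  (∀ H H' → B2 G H H' → size H + size H' ≤ l)

IsAlpha2 : ∀ {n} → SimpleGraph n → ℕ → Set
IsAlpha2 G a = ∃ λ l → IsLambda2 G l ×
  (∃₂ λ H H' → B2 G H H' × size H + size H' ≡ l × (size H ≡ a ⊎ size H' ≡ a)) ×
  (∀ H H' → B2 G H H' → size H + size H' ≡ l → size H ≤ a × size H' ≤ a)

InM2 : ∀ {n} → SimpleGraph n → EdgeSet n → EdgeSet n → Set
InM2 G H H' = B2 G H H' × IsLambda2 G (size H + size H') × IsAlpha2 G (size H)

Standing : ∀ {n} → SimpleGraph n → EdgeSet n → EdgeSet n → EdgeSet n → Set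
Standing G H H' M =
  InM2 G H H' × IsMaxMatching G M ×
  (∀ K K' N → InM2 G K K' → IsMaxMatching G N → size (N ∩ K) ≤ size (M ∩ H)) ×
  (∀ K K' N → InM2 G K K' → IsMaxMatching G N → size (N ∩ K) ≡ size (M ∩ H) →
     size (N ∩ K') ≤ size (M ∩ H'))

-- Alternating paths and cycles.  A path is given by its list of vertices
-- v₀ v₁ … v_l (pairwise distinct); its edges are {v_{i-1}, v_i}.

edgesOf : ∀ {n} → List (Fin n) → List (Fin n × Fin n)
edgesOf (x ∷ y ∷ xs) = (x , y) ∷ edgesOf (y ∷ xs)
edgesOf _ = []

cycleEdgesOf : ∀ {n} → List (Fin n) → List (Fin n × Fin n)
cycleEdgesOf [] = []
cycleEdgesOf (x ∷ xs) = edgesOf ((x ∷ xs) ++ (x ∷ []))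

InDiff : ∀ {n} → EdgeSet n → EdgeSet n → Fin n × Fin n → Set
InDiff A B (u , v) = A u v ≡ true × B u v ≡ false

data Alt {n} (A B : EdgeSet n) : List (Fin n × Fin n) → Set where
  []  : Alt A B []
  _∷_ : ∀ {e es} → InDiff A B e → Alt B A es → Alt A B (e ∷ es)

Even Odd : ℕ → Set
Even m = ∃ λ k → m ≡ 2 * k
Odd m = ∃ λ k → m ≡ suc (2 * k)

AltPath : ∀ {n} → EdgeSet n → EdgeSet n → List (Fin n) → Set
AltPath A B p = Unique p × 1 ≤ length (edgesOf p) ×
  (Alt A B (edgesOf p) ⊎ Alt B A (edgesOf p))

AltCycle : ∀ {n} → EdgeSet n → EdgeSet n → List (Fin n) → Set
AltCycle A B c = Unique c × 3 ≤ length c × Even (length c) ×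
  (Alt A B (cycleEdgesOf c) ⊎ Alt B A (cycleEdgesOf c))

Infix : ∀ {n} → List (Fin n) → List (Fin n) → Set
Infix p q = ∃₂ λ xs ys → q ≡ xs ++ (p ++ ys)

ProperSubpath : ∀ {n} → List (Fin n) → List (Fin n) → Set
ProperSubpath p q = (Infix p q ⊎ Infix (reverse p) q) × length p < length q

SubpathOfCycle : ∀ {n} → List (Fin n) → List (Fin n) → Set
SubpathOfCycle p c = Infix p (c ++ c) ⊎ Infix (reverse p) (c ++ c)

MaxAltPath : ∀ {n} → EdgeSet n → EdgeSet n → List (Fin n) → Set
MaxAltPath A B p = AltPath A B p ×
  ¬ (∃ λ q → AltPath A B q × ProperSubpath p q) ×
  ¬ (∃ λ c → AltCycle A B c × SubpathOfCycle p c)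

-- an undirected path is counted once: we take the orientation whose first
-- vertex has the smaller index
head? : ∀ {n} → List (Fin n) → ℕ
head? [] = 0
head? (x ∷ _) = toℕ x

last? : ∀ {n} → List (Fin n) → ℕ
last? [] = 0
last? (x ∷ []) = toℕ x
last? (_ ∷ y ∷ ys) = last? (y ∷ ys)

Canonical : ∀ {n} → List (Fin n) → Set
Canonical p = head? p < last? p

-- P_o^A(A,B) : maximal A-B alternating paths of odd length, first edge in A
PoA : ∀ {n} → EdgeSet n → EdgeSet n → List (Fin n) → Set
PoA A B p = MaxAltPath A B p × Alt A B (edgesOf p) × Odd (length (edgesOf p)) × Canonical p

-- P_o^B(A,B) : maximal A-B alternating paths of odd length, first edge in B
PoB : ∀ {n} → EdgeSet n → EdgeSet n → List (Fin n) → Set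
PoB A B p = MaxAltPath A B p × Alt B A (edgesOf p) × Odd (length (edgesOf p)) × Canonical p

Card : {X : Set} → (X → Set) → ℕ → Set
Card {X} P k = Σ (List X) λ L → Unique L ×
  (∀ x → x ∈ L → P x) × (∀ x → P x → x ∈ L) × length L ≡ k

OnPath : ∀ {n} → Fin n → Fin n → List (Fin n) → Set
OnPath i j p = (i , j) ∈ edgesOf p ⊎ (j , i) ∈ edgesOf p

IsMA : ∀ {n} → EdgeSet n → EdgeSet n → EdgeSet n → Set
IsMA M H MA = ∀ i j →
  (MA i j ≡ true → M i j ≡ true × ∃ λ p → PoA M H p × OnPath i j p) ×
  (M i j ≡ true × (∃ λ p → PoA M H p × OnPath i j p) → MA i j ≡ true)

IsHA : ∀ {n} → EdgeSet n → EdgeSet n → EdgeSet n → Set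
IsHA M H HA = ∀ i j →
  (HA i j ≡ true → H i j ≡ true × ∃ λ p → PoA M H p × OnPath i j p) ×
  (H i j ≡ true × (∃ λ p → PoA M H p × OnPath i j p) → HA i j ≡ true)

-- For two matchings X and Y, every vertex v satisfies
--   deg_Y v + [v ends an alternating path with end edge in X] = deg_X v + [the same with X, Y swapped].
-- Summed over all v this gives 2|Y| + o_X = 2|X| + o_Y, where o_X counts the ends of odd maximal
-- alternating paths whose end edges lie in X: the even paths cancel in pairs, because exchanging the two
-- ends of a maximal alternating path is an involution.
-- For (M, H) there is no odd path with end edges in H, since it would augment M; hence 2|H| + e = 2|M|
-- with e the number of ends of paths in P_o^M(M,H). For (M_A, H') there is none with end edges in M_A,
-- since switching it would enlarge H' while keeping it disjoint from H, against the maximality of λ₂;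
-- hence 2|H'| = 2|M_A| + 2|P_o^{H'}(M_A,H')|. Finally a vertex is covered by M_A exactly when it is covered
-- by H_A or is one of the e path ends, never both, so 2|M_A| = 2|H_A| + e. As |M| = ν and |H| = α₂,
-- eliminating e gives the formula.

module Submission where

open import Defs
open import Data.Nat.Properties
open import Algebra.Properties.CommutativeMonoid.Sum +-0-commutativeMonoid
  using (sum-cong-≗; sum-replicate-zero; ∑-distrib-+; ∑-comm; ∑-permute)
  renaming (sum to ∑)
open import Data.Bool using (Bool; true; false; _∧_; _∨_; _xor_; not; T; if_then_else_)
open import Data.Bool.Properties using (∧-zeroʳ; ¬-not; not-¬; not-involutive; xor-identityʳ; ⇔→≡) renaming (_≟_ to _≟ᵇ_)
open import Data.Empty using (⊥; ⊥-elim)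
open import Data.Fin using (Fin; zero; suc; toℕ)
open import Data.Fin.Permutation using (permutation)
open import Data.Fin.Properties using (toℕ-injective; pigeonhole; any?)
  renaming (_≟_ to _≟ᶠ_; <-irrefl to <ᶠ-irrefl; suc-injective to sucᶠ-injective)
open import Data.List using (List; []; _∷_; _++_; length; reverse; map; concatMap; tabulate; allFin; lookup; filter)
open import Data.List.Membership.Propositional using (_∈_; _∉_)
open import Data.List.Membership.Propositional.Properties
  using (∈-lookup; ∈-++⁺ˡ; ∈-++⁺ʳ; ∈-++⁻; ∈-map⁺; ∈-map⁻; ∈-filter⁺; ∈-filter⁻; ∈-allFin)
open import Data.List.Properties
  using (map-tabulate; map-++; map-∘; length-++; ++-identityʳ; length-reverse; unfold-reverse; length-map; ∷-injectiveˡ)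
open import Data.List.Relation.Unary.All using (All; []; _∷_) renaming (lookup to All-lookup)
open import Data.List.Relation.Unary.AllPairs using ([]; _∷_)
import Data.List.Relation.Unary.AllPairs as AllPairs
open import Data.List.Relation.Unary.Any using (here; there)
open import Data.List.Relation.Unary.Any.Properties using (reverse⁺)
open import Data.List.Relation.Unary.Unique.Propositional using (Unique)
open import Data.List.Relation.Unary.Unique.Propositional.Properties
  using (map⁺; filter⁺; allFin⁺) renaming (++⁺ to Unique-++⁺)
open import Data.Nat using (ℕ; zero; suc; _+_; _*_; _∸_; _≤_; _<_; _<ᵇ_; z≤n; s≤s)
open import Data.Nat.ListAction using (sum)
open import Data.Nat.ListAction.Properties using (sum-++)
open import Data.Nat.Tactic.RingSolver using (solve-∀)
open import Data.Product using (∃; ∃₂; _×_; _,_; proj₁; proj₂)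
open import Data.Product.Properties using (≡-dec)
open import Data.Sum using (_⊎_; inj₁; inj₂; [_,_]′; reduce)
open import Function using (_∘_; id)
open import Function.Bundles using (_⇔_; mk⇔)
open import Relation.Nullary using (¬_; Dec; yes; no; does; ¬?)
open import Relation.Nullary.Decidable using (_×-dec_; _⊎-dec_; does-⇔; dec-true; dec-false)
open import Relation.Binary.PropositionalEquality
open import Relation.Binary.Definitions using (tri<; tri≈; tri>)

private variable
  A : Set
  n : ℕ

true≢false : true ≢ false
true≢false ()

𝟙 : Bool → ℕ
𝟙 true = 1
𝟙 false = 0

#_ : ∀ {n} → (Fin n → Bool) → ℕ
# f = ∑ (𝟙 ∘ f)

∑-zero : ∀ {n} (f : Fin n → ℕ) → (∀ i → f i ≡ 0) → ∑ f ≡ 0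
∑-zero {n} f f≡0 = trans (sum-cong-≗ f≡0) (sum-replicate-zero n)

∑-concentrated : ∀ {n} (a : Fin n) (f : Fin n → ℕ) → (∀ i → i ≢ a → f i ≡ 0) → ∑ f ≡ f a
∑-concentrated zero f f≡0 =
  trans (cong (f zero +_) (∑-zero (f ∘ suc) (λ i → f≡0 (suc i) λ ()))) (+-identityʳ _)
∑-concentrated (suc a) f f≡0 =
  trans (cong (_+ ∑ (f ∘ suc)) (f≡0 zero λ ()))
        (∑-concentrated a (f ∘ suc) (λ i i≢a → f≡0 (suc i) (i≢a ∘ sucᶠ-injective)))

∑-involution : ∀ {n} (F : Fin n → Fin n) → (∀ i → F (F i) ≡ i) → (f : Fin n → ℕ) →
  ∑ (f ∘ F) ≡ ∑ f
∑-involution F F∘F f = sym (∑-permute f (permutation F F F∘F F∘F))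

∑-double-count : ∀ {n} (f : Fin n → Fin n → ℕ) →
  ∑ (λ i → ∑ (λ j → f i j + f j i)) ≡ ∑ (λ i → ∑ (f i)) + ∑ (λ i → ∑ (f i))
∑-double-count f = begin
  ∑ (λ i → ∑ (λ j → f i j + f j i))
    ≡⟨ sum-cong-≗ (λ i → ∑-distrib-+ (f i) (λ j → f j i)) ⟩
  ∑ (λ i → ∑ (f i) + ∑ (λ j → f j i))
    ≡⟨ ∑-distrib-+ (λ i → ∑ (f i)) (λ i → ∑ (λ j → f j i)) ⟩
  ∑ (λ i → ∑ (f i)) + ∑ (λ i → ∑ (λ j → f j i))
    ≡⟨ cong (∑ (λ i → ∑ (f i)) +_) (∑-comm (λ i j → f j i)) ⟩
  ∑ (λ i → ∑ (f i)) + ∑ (λ i → ∑ (f i)) ∎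
  where open ≡-Reasoning

sum-concatMap : ∀ {A C : Set} (g : C → ℕ) (h : A → List C) (xs : List A) →
  sum (map g (concatMap h xs)) ≡ sum (map (λ x → sum (map g (h x))) xs)
sum-concatMap g h [] = refl
sum-concatMap g h (x ∷ xs) = begin
  sum (map g (h x ++ concatMap h xs))
    ≡⟨ cong sum (map-++ g (h x) (concatMap h xs)) ⟩
  sum (map g (h x) ++ map g (concatMap h xs))
    ≡⟨ sum-++ (map g (h x)) _ ⟩
  sum (map g (h x)) + sum (map g (concatMap h xs))
    ≡⟨ cong (sum (map g (h x)) +_) (sum-concatMap g h xs) ⟩
  sum (map g (h x)) + sum (map (λ x → sum (map g (h x))) xs) ∎
  where open ≡-Reasoning

sum-tabulate : ∀ {n} (h : Fin n → ℕ) → sum (tabulate h) ≡ ∑ h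
sum-tabulate {zero} h = refl
sum-tabulate {suc n} h = cong (h zero +_) (sum-tabulate (h ∘ suc))

sum-map-allFin : ∀ {n} (h : Fin n → ℕ) → sum (map h (allFin n)) ≡ ∑ h
sum-map-allFin h = trans (cong sum (map-tabulate id h)) (sum-tabulate h)

lookup-injective : ∀ {n} {xs : List (Fin n)} → Unique xs → ∀ {i j} → lookup xs i ≡ lookup xs j → i ≡ j
lookup-injective {xs = _ ∷ _} _ {zero} {zero} _ = refl
lookup-injective {xs = _ ∷ _} (x∉ ∷ _) {zero} {suc j} eq = ⊥-elim (All-lookup x∉ (∈-lookup j) eq)
lookup-injective {xs = _ ∷ _} (x∉ ∷ _) {suc i} {zero} eq = ⊥-elim (All-lookup x∉ (∈-lookup i) (sym eq))
lookup-injective {xs = _ ∷ _} (_ ∷ u) {suc i} {suc j} eq = cong suc (lookup-injective u eq)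

unique-length≤ : ∀ {n} (xs : List (Fin n)) → Unique xs → length xs ≤ n
unique-length≤ xs u = ≮⇒≥ λ n<len →
  let (i , j , i<j , eq) = pigeonhole n<len (lookup xs) in <ᶠ-irrefl (lookup-injective u eq) i<j

before : ∀ {n} → Fin n → Fin n → Bool
before i j = toℕ i <ᵇ toℕ j

before⇒< : ∀ {n} {i j : Fin n} → before i j ≡ true → toℕ i < toℕ j
before⇒< {i = i} {j} eq = <ᵇ⇒< (toℕ i) (toℕ j) (subst T (sym eq) _)

≮⇒before-false : ∀ {n} {i j : Fin n} → ¬ toℕ i < toℕ j → before i j ≡ false
≮⇒before-false {i = i} {j} i≮j with before i j in eq
... | true = ⊥-elim (i≮j (before⇒< eq))
... | false = refl

<⇒before : ∀ {n} {i j : Fin n} → toℕ i < toℕ j → before i j ≡ true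
<⇒before {i = i} {j} i<j with before i j in eq
... | true = refl
... | false = ⊥-elim (subst T eq (<⇒<ᵇ i<j))

before-trichotomy : ∀ {n} (i j : Fin n) →
  (before i j ≡ true × before j i ≡ false) ⊎ (before i j ≡ false × before j i ≡ true) ⊎ i ≡ j
before-trichotomy i j with <-cmp (toℕ i) (toℕ j)
... | tri< i<j _ j≮i = inj₁ (<⇒before i<j , ≮⇒before-false j≮i)
... | tri≈ _ i≡j _ = inj₂ (inj₂ (toℕ-injective i≡j))
... | tri> i≮j _ j<i = inj₂ (inj₁ (≮⇒before-false i≮j , <⇒before j<i))

size≡∑ : ∀ {n} (S : EdgeSet n) → size S ≡ ∑ (λ i → ∑ (λ j → 𝟙 (before i j ∧ S i j)))
size≡∑ {n} S = begin
  size S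
    ≡⟨ sum-concatMap count row (allFin n) ⟩
  sum (map (λ i → sum (map count (row i))) (allFin n))
    ≡⟨ sum-map-allFin (λ i → sum (map count (row i))) ⟩
  ∑ (λ i → sum (map count (row i)))
    ≡⟨ sum-cong-≗ (λ i → trans (cong sum (sym (map-∘ (allFin n))))
                               (trans (sum-map-allFin (count ∘ (i ,_))) (sum-cong-≗ (λ j → if-𝟙 (before i j ∧ S i j))))) ⟩
  ∑ (λ i → ∑ (λ j → 𝟙 (before i j ∧ S i j))) ∎
  where
  open ≡-Reasoning
  count : Fin n × Fin n → ℕ
  count (i , j) = if before i j ∧ S i j then 1 else 0
  row : Fin n → List (Fin n × Fin n)
  row i = map (i ,_) (allFin n)
  if-𝟙 : ∀ b → (if b then 1 else 0) ≡ 𝟙 b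
  if-𝟙 true = refl
  if-𝟙 false = refl

record IsMatchingSet {n} (S : EdgeSet n) : Set where
  field
    symmetric  : ∀ i j → S i j ≡ S j i
    loopless   : ∀ i → S i i ≡ false
    functional : ∀ i j k → S i j ≡ true → S i k ≡ true → j ≡ k

IsMatching⇒IsMatchingSet : ∀ {n} {G : SimpleGraph n} {S : EdgeSet n} → IsMatching G S → IsMatchingSet S
IsMatching⇒IsMatchingSet {G = G} {S} ((sym-S , S⊆G) , fun-S) = record
  { symmetric = sym-S ; loopless = loopless ; functional = fun-S }
  where
  loopless : ∀ i → S i i ≡ false
  loopless i with S i i in eq
  ... | true = ⊥-elim (true≢false (trans (sym (S⊆G i i eq)) (adj-irrefl G i)))
  ... | false = refl

degree : ∀ {n} → EdgeSet n → Fin n → ℕ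
degree S i = ∑ (λ j → 𝟙 (S i j))

handshake : ∀ {n} {S : EdgeSet n} → IsMatchingSet S → ∑ (degree S) ≡ size S + size S
handshake {S = S} m = begin
  ∑ (degree S)
    ≡⟨ sum-cong-≗ (λ i → sum-cong-≗ (split i)) ⟩
  ∑ (λ i → ∑ (λ j → 𝟙 (before i j ∧ S i j) + 𝟙 (before j i ∧ S j i)))
    ≡⟨ ∑-double-count (λ i j → 𝟙 (before i j ∧ S i j)) ⟩
  ∑ (λ i → ∑ (λ j → 𝟙 (before i j ∧ S i j))) + ∑ (λ i → ∑ (λ j → 𝟙 (before i j ∧ S i j)))
    ≡⟨ sym (cong₂ _+_ (size≡∑ S) (size≡∑ S)) ⟩
  size S + size S ∎
  where
  open ≡-Reasoning
  open IsMatchingSet m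
  split : ∀ i j → 𝟙 (S i j) ≡ 𝟙 (before i j ∧ S i j) + 𝟙 (before j i ∧ S j i)
  split i j rewrite symmetric j i with before-trichotomy i j
  ... | inj₁ (i<j , j≮i) rewrite i<j | j≮i = sym (+-identityʳ _)
  ... | inj₂ (inj₁ (i≮j , j<i)) rewrite i≮j | j<i = refl
  ... | inj₂ (inj₂ refl) rewrite loopless i | ∧-zeroʳ (before i i) = refl

degree≡1 : ∀ {n} {S : EdgeSet n} → IsMatchingSet S → ∀ {i a} → S i a ≡ true → degree S i ≡ 1
degree≡1 {S = S} m {i} {a} Sia = trans (∑-concentrated a (λ j → 𝟙 (S i j)) off-a) (cong 𝟙 Sia)
  where
  off-a : ∀ j → j ≢ a → 𝟙 (S i j) ≡ 0
  off-a j j≢a with S i j in Sij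
  ... | true = ⊥-elim (j≢a (IsMatchingSet.functional m i j a Sij Sia))
  ... | false = refl

degree≡0 : ∀ {n} (S : EdgeSet n) {i} → (∀ j → S i j ≡ false) → degree S i ≡ 0
degree≡0 S none = ∑-zero _ (λ j → cong 𝟙 (none j))

Covered : ∀ {n} → EdgeSet n → Fin n → Set
Covered S v = ∃ λ u → S v u ≡ true

covered? : ∀ {n} (S : EdgeSet n) v → Dec (Covered S v)
covered? S v = any? (λ u → S v u ≟ᵇ true)

degree≡𝟙covered : ∀ {n} {S : EdgeSet n} → IsMatchingSet S → ∀ v → degree S v ≡ 𝟙 (does (covered? S v))
degree≡𝟙covered {S = S} m v with covered? S v
... | yes (a , Sva) = degree≡1 m Sva
... | no uncovered = degree≡0 S (λ j → ¬-not (λ Svj → uncovered (j , Svj)))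

length-filter-tabulate : ∀ {n} {A : Set} (f : A → Bool) (g : Fin n → A) →
  length (filter (λ x → f x ≟ᵇ true) (tabulate g)) ≡ ∑ (𝟙 ∘ f ∘ g)
length-filter-tabulate {zero} f g = refl
length-filter-tabulate {suc n} f g with f (g zero)
... | true = cong suc (length-filter-tabulate f (g ∘ suc))
... | false = length-filter-tabulate f (g ∘ suc)

double-injective : ∀ {a c} → a + a ≡ c + c → a ≡ c
double-injective {zero} {zero} _ = refl
double-injective {suc a} {suc c} eq =
  cong suc (double-injective (suc-injective (trans (sym (+-suc a a)) (trans (suc-injective eq) (+-suc c c)))))

#-none : ∀ {n} {P : Fin n → Set} (P? : ∀ v → Dec (P v)) → (∀ v → ¬ P v) → # (does ∘ P?) ≡ 0
#-none P? none = ∑-zero _ λ v → cong 𝟙 (dec-false (P? v) (none v))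

𝟙-∨ : ∀ {A B : Set} (a? : Dec A) (b? : Dec B) → (A → ¬ B) → 𝟙 (does a? ∨ does b?) ≡ 𝟙 (does a?) + 𝟙 (does b?)
𝟙-∨ (yes a) (yes b) a⇒¬b = ⊥-elim (a⇒¬b a b)
𝟙-∨ (yes _) (no _) _ = refl
𝟙-∨ (no _) _ _ = refl

OnPath-sym : ∀ {x y : Fin n} {p} → OnPath x y p → OnPath y x p
OnPath-sym (inj₁ e) = inj₂ e
OnPath-sym (inj₂ e) = inj₁ e

OnPath-there : ∀ {x y z w : Fin n} {r} → OnPath x y (w ∷ r) → OnPath x y (z ∷ w ∷ r)
OnPath-there (inj₁ e) = inj₁ (there e)
OnPath-there (inj₂ e) = inj₂ (there e)

OnPath-first : ∀ {x y : Fin n} {r} → OnPath x y (x ∷ y ∷ r)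
OnPath-first = inj₁ (here refl)

edge-endpoints : ∀ {u v : Fin n} p → (u , v) ∈ edgesOf p → u ∈ p × v ∈ p
edge-endpoints (x ∷ y ∷ r) (here refl) = here refl , there (here refl)
edge-endpoints (x ∷ y ∷ r) (there e) = let (u∈ , v∈) = edge-endpoints (y ∷ r) e in there u∈ , there v∈

OnPath-endpoints : ∀ {u v : Fin n} p → OnPath u v p → u ∈ p × v ∈ p
OnPath-endpoints p (inj₁ e) = edge-endpoints p e
OnPath-endpoints p (inj₂ e) = let (v∈ , u∈) = edge-endpoints p e in u∈ , v∈

lastFrom : A → List A → A
lastFrom d [] = d
lastFrom _ (x ∷ xs) = lastFrom x xs

lastFrom∈ : ∀ (x : A) xs → lastFrom x xs ∈ x ∷ xs
lastFrom∈ x [] = here refl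
lastFrom∈ x (y ∷ xs) = there (lastFrom∈ y xs)

lastFrom-snoc : ∀ (h : A) r u → lastFrom h (r ++ u ∷ []) ≡ u
lastFrom-snoc h [] u = refl
lastFrom-snoc h (w ∷ r) u = lastFrom-snoc w r u

lastFrom-++ : ∀ (d : A) as y ys → lastFrom d (as ++ y ∷ ys) ≡ lastFrom y ys
lastFrom-++ d [] y ys = refl
lastFrom-++ d (a ∷ as) y ys = lastFrom-++ a as y ys

head∉tail : ∀ {h : A} {r} → Unique (h ∷ r) → h ∉ r
head∉tail (h∉ ∷ _) h∈ = All-lookup h∉ h∈ refl

-- The side of the edge that would extend, at its last vertex, an alternating path starting on side b.
nextSide : Bool → List A → Bool
nextSide b (x ∷ y ∷ r) = nextSide (not b) (y ∷ r)
nextSide b _ = b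

nextSide-snoc : ∀ b (h : A) r u → nextSide b (h ∷ (r ++ u ∷ [])) ≡ not (nextSide b (h ∷ r))
nextSide-snoc b h [] u = refl
nextSide-snoc b h (w ∷ r) u = nextSide-snoc (not b) w r u

length-edgesOf : ∀ (h : Fin n) r → length (edgesOf (h ∷ r)) ≡ length r
length-edgesOf h [] = refl
length-edgesOf h (w ∷ r) = cong suc (length-edgesOf w r)

nextSide-parity : ∀ b (h : A) r →
  (nextSide b (h ∷ r) ≡ b × Even (length r)) ⊎ (nextSide b (h ∷ r) ≡ not b × Odd (length r))
nextSide-parity b h [] = inj₁ (refl , 0 , refl)
nextSide-parity b h (w ∷ r) with nextSide-parity (not b) w r
... | inj₁ (e , k , len≡) = inj₂ (e , k , cong suc len≡)
... | inj₂ (e , k , len≡) = inj₁ (trans e (not-involutive b) , suc k , cong suc (trans len≡ (sym (+-suc k (k + 0)))))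

¬even∧odd : ∀ {m} → Even m → Odd m → ⊥
¬even∧odd (k , refl) (j , 2k≡1+2j) = go k j 2k≡1+2j
  where
  go : ∀ k j → 2 * k ≡ suc (2 * j) → ⊥
  go zero j ()
  go (suc k) zero eq = 0≢1+n (sym (suc-injective (trans (sym (*-suc 2 k)) eq)))
  go (suc k) (suc j) eq = go k j (suc-injective (suc-injective (trans (sym (*-suc 2 k)) (trans eq (cong suc (*-suc 2 j))))))

odd⇒nextSide : ∀ b (h : A) r → Odd (length r) → nextSide b (h ∷ r) ≡ not b
odd⇒nextSide b h r odd with nextSide-parity b h r
... | inj₁ (_ , even) = ⊥-elim (¬even∧odd even odd)
... | inj₂ (e , _) = e

nextSide⇒odd : ∀ b (h : A) r → nextSide b (h ∷ r) ≡ not b → Odd (length r)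
nextSide⇒odd b h r e with nextSide-parity b h r
... | inj₁ (e' , _) = ⊥-elim (not-¬ refl (trans (sym e') e))
... | inj₂ (_ , odd) = odd

odd⇒even-suc : ∀ {m} → Odd m → Even (suc m)
odd⇒even-suc (k , refl) = suc k , sym (*-suc 2 k)

same-or-flipped : ∀ s b → s ≡ b ⊎ s ≡ not b
same-or-flipped true true = inj₁ refl
same-or-flipped true false = inj₂ refl
same-or-flipped false true = inj₂ refl
same-or-flipped false false = inj₁ refl

∉⇒All≢ : ∀ {x : A} xs → x ∉ xs → All (x ≢_) xs
∉⇒All≢ [] _ = []
∉⇒All≢ (y ∷ ys) x∉ = (λ e → x∉ (here e)) ∷ ∉⇒All≢ ys (x∉ ∘ there)

Unique-snoc : ∀ (xs : List A) {u} → Unique xs → u ∉ xs → Unique (xs ++ u ∷ [])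
Unique-snoc xs un u∉ = Unique-++⁺ un ([] ∷ []) λ { (u∈ , here refl) → u∉ u∈ }

length-snoc : ∀ (xs : List A) u → length (xs ++ u ∷ []) ≡ suc (length xs)
length-snoc xs u = trans (length-++ xs) (+-comm (length xs) 1)

Infix⇒⊆ : ∀ {x : Fin n} {p q : List (Fin n)} → Infix p q → x ∈ p → x ∈ q
Infix⇒⊆ (xs , ys , refl) x∈ = ∈-++⁺ʳ xs (∈-++⁺ˡ x∈)

Unique-++-disjoint : ∀ (as : List A) {bs x} → Unique (as ++ bs) → x ∈ as → x ∈ bs → ⊥
Unique-++-disjoint (a ∷ as) (a∉ ∷ _) (here refl) x∈bs = All-lookup a∉ (∈-++⁺ʳ as x∈bs) refl
Unique-++-disjoint (a ∷ as) (_ ∷ un) (there x∈as) x∈bs = Unique-++-disjoint as un x∈as x∈bs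

infix-containing-ends : ∀ (p : List (Fin n)) xs ys h r → h ∷ r ≡ xs ++ (p ++ ys) → Unique (h ∷ r) →
  h ∈ p → lastFrom h r ∈ p → length (h ∷ r) ≡ length p
infix-containing-ends p (x ∷ xs) ys h r refl (h∉ ∷ _) h∈ _ = ⊥-elim (All-lookup h∉ (∈-++⁺ʳ xs (∈-++⁺ˡ h∈)) refl)
infix-containing-ends p [] [] h r eq un h∈ t∈ = trans (cong length eq) (cong length (++-identityʳ p))
infix-containing-ends p [] (y ∷ ys) h r eq un h∈ t∈ =
  let t∈' = subst (_∈ p) (trans (cong (lastFrom h) eq) (lastFrom-++ h p y ys)) t∈
  in ⊥-elim (Unique-++-disjoint p (subst Unique eq un) t∈' (lastFrom∈ y ys))

oriented-infix : ∀ {p q : List (Fin n)} → Infix p q ⊎ Infix (reverse p) q →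
  ∃ λ p' → Infix p' q × (∀ {x} → x ∈ p → x ∈ p') × length p' ≡ length p
oriented-infix {p = p} (inj₁ i) = p , i , id , refl
oriented-infix {p = p} (inj₂ i) = reverse p , i , reverse⁺ , length-reverse p

SubpathOfCycle⇒⊆ : ∀ {p : List (Fin n)} c → SubpathOfCycle p c → ∀ {x} → x ∈ p → x ∈ c
SubpathOfCycle⇒⊆ c (inj₁ i) x∈ = reduce (∈-++⁻ c (Infix⇒⊆ i x∈))
SubpathOfCycle⇒⊆ c (inj₂ i) x∈ = reduce (∈-++⁻ c (Infix⇒⊆ i (reverse⁺ x∈)))

reverse-shape : ∀ (h : A) r → ∃ λ r' → reverse (h ∷ r) ≡ lastFrom h r ∷ r'
reverse-shape h [] = [] , refl
reverse-shape h (w ∷ r) =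
  let (r' , e) = reverse-shape w r in r' ++ h ∷ [] , trans (unfold-reverse h (w ∷ r)) (cong (_++ h ∷ []) e)

lastFrom-reverse : ∀ (d h : A) r → lastFrom d (reverse (h ∷ r)) ≡ h
lastFrom-reverse d h r = trans (cong (lastFrom d) (unfold-reverse h r)) (lastFrom-snoc d (reverse r) h)

last?≡lastFrom : ∀ (x : Fin n) xs → last? (x ∷ xs) ≡ toℕ (lastFrom x xs)
last?≡lastFrom x [] = refl
last?≡lastFrom x (y ∷ xs) = last?≡lastFrom y xs

module Alternation {n : ℕ} {X Y : EdgeSet n} (X-matching : IsMatchingSet X) (Y-matching : IsMatchingSet Y) where

  V : Set
  V = Fin n

  open import Data.List.Membership.DecPropositional (_≟ᶠ_ {n}) using (_∈?_)
  open import Data.List.Membership.DecPropositional (≡-dec (_≟ᶠ_ {n}) (_≟ᶠ_ {n})) using () renaming (_∈?_ to _∈ₑ?_)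

  side : Bool → EdgeSet n
  side true = X
  side false = Y

  side-matching : ∀ b → IsMatchingSet (side b)
  side-matching true = X-matching
  side-matching false = Y-matching

  open IsMatchingSet

  record Diff (b : Bool) (u v : V) : Set where
    constructor diff
    field
      on-side  : side b u v ≡ true
      off-side : side (not b) u v ≡ false
  open Diff public

  Diff-sym : ∀ {b u v} → Diff b u v → Diff b v u
  Diff-sym {b} {u} {v} (diff on off) =
    diff (trans (symmetric (side-matching b) v u) on) (trans (symmetric (side-matching (not b)) v u) off)

  Diff-functional : ∀ {b u v w} → Diff b u v → Diff b u w → v ≡ w
  Diff-functional {b} d d' = functional (side-matching b) _ _ _ (on-side d) (on-side d')

  Diff-irrefl : ∀ {b u} → ¬ Diff b u u
  Diff-irrefl {b} {u} d = true≢false (trans (sym (on-side d)) (loopless (side-matching b) u))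

  Diff-exclusive : ∀ {b u v} → Diff b u v → ¬ Diff (not b) u v
  Diff-exclusive d d' = true≢false (trans (sym (on-side d')) (off-side d))

  Diff? : ∀ b u v → Dec (Diff b u v)
  Diff? b u v with side b u v in on | side (not b) u v in off
  ... | true | false = yes (diff on off)
  ... | false | _ = no (λ d → true≢false (trans (sym (on-side d)) on))
  ... | true | true = no (λ d → true≢false (trans (sym off) (off-side d)))

  AltFrom : Bool → List (V × V) → Set
  AltFrom true = Alt X Y
  AltFrom false = Alt Y X

  alt-nil : ∀ b → AltFrom b []
  alt-nil true = []
  alt-nil false = []

  alt-cons : ∀ {b u v es} → Diff b u v → AltFrom (not b) es → AltFrom b ((u , v) ∷ es)
  alt-cons {true} (diff on off) al = (on , off) ∷ al
  alt-cons {false} (diff on off) al = (on , off) ∷ al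

  alt-head : ∀ {b u v es} → AltFrom b ((u , v) ∷ es) → Diff b u v
  alt-head {true} ((on , off) ∷ _) = diff on off
  alt-head {false} ((on , off) ∷ _) = diff on off

  alt-tail : ∀ {b e es} → AltFrom b (e ∷ es) → AltFrom (not b) es
  alt-tail {true} (_ ∷ al) = al
  alt-tail {false} (_ ∷ al) = al

  AltFrom⇒Alt : ∀ b {es} → AltFrom b es → Alt X Y es ⊎ Alt Y X es
  AltFrom⇒Alt true al = inj₁ al
  AltFrom⇒Alt false al = inj₂ al

  Alt⇒AltFrom : ∀ {es} → Alt X Y es ⊎ Alt Y X es → ∃ λ b → AltFrom b es
  Alt⇒AltFrom (inj₁ al) = true , al
  Alt⇒AltFrom (inj₂ al) = false , al

  edge-Diff : ∀ b p {x y} → AltFrom b (edgesOf p) → (x , y) ∈ edgesOf p → Diff b x y ⊎ Diff (not b) x y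
  edge-Diff b (h ∷ w ∷ r) al (here refl) = inj₁ (alt-head al)
  edge-Diff b (h ∷ w ∷ r) {x} {y} al (there e) with edge-Diff (not b) (w ∷ r) (alt-tail al) e
  ... | inj₁ d = inj₂ d
  ... | inj₂ d = inj₁ (subst (λ c → Diff c x y) (not-involutive b) d)

  OnPath-Diff : ∀ b p {x y} → AltFrom b (edgesOf p) → OnPath x y p → Diff b x y ⊎ Diff (not b) x y
  OnPath-Diff b p al (inj₁ e) = edge-Diff b p al e
  OnPath-Diff b p al (inj₂ e) with edge-Diff b p al e
  ... | inj₁ d = inj₁ (Diff-sym d)
  ... | inj₂ d = inj₂ (Diff-sym d)

  Stuck : Bool → V → Set
  Stuck b t = ∀ u → ¬ Diff b t u

  Interior : V → List V → Set
  Interior x p = ∀ s → ∃ λ c → OnPath x c p × Diff s x c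

  position : ∀ {b} h r {x} → AltFrom b (edgesOf (h ∷ r)) → x ∈ h ∷ r →
    x ≡ h ⊎ x ≡ lastFrom h r ⊎ Interior x (h ∷ r)
  position h r al (here refl) = inj₁ refl
  position {b} h (w ∷ r) al (there x∈) with position {not b} w r (alt-tail al) x∈
  ... | inj₂ (inj₁ e) = inj₂ (inj₁ e)
  ... | inj₂ (inj₂ int) = inj₂ (inj₂ λ s → let (c , on , d) = int s in c , OnPath-there on , d)
  position {b} h (w ∷ []) al (there x∈) | inj₁ refl = inj₂ (inj₁ refl)
  position {b} h (w ∷ z ∷ r) al (there x∈) | inj₁ refl = inj₂ (inj₂ both)
    where
    both : Interior w (h ∷ w ∷ z ∷ r)
    both s with same-or-flipped s b
    ... | inj₁ refl = h , inj₂ (here refl) , Diff-sym (alt-head al)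
    ... | inj₂ refl = z , inj₁ (there (here refl)) , alt-head (alt-tail al)

  last-edge : ∀ b h w r → AltFrom b (edgesOf (h ∷ w ∷ r)) →
    ∃ λ a → OnPath a (lastFrom w r) (h ∷ w ∷ r) × Diff (not (nextSide b (h ∷ w ∷ r))) (lastFrom w r) a
  last-edge b h w [] al rewrite not-involutive b = h , OnPath-first {r = []} , Diff-sym (alt-head al)
  last-edge b h w (z ∷ r) al = let (a , on , d) = last-edge (not b) w z r (alt-tail al) in a , OnPath-there on , d

  head-edge-side : ∀ b h w r {x} → Unique (h ∷ w ∷ r) → AltFrom b (edgesOf (h ∷ w ∷ r)) →
    OnPath x h (h ∷ w ∷ r) → Diff b h x
  head-edge-side b h w r u al (inj₁ (here refl)) = ⊥-elim (head∉tail u (here refl))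
  head-edge-side b h w r u al (inj₂ (here refl)) = alt-head al
  head-edge-side b h w r u al (inj₁ (there e)) = ⊥-elim (head∉tail u (proj₂ (edge-endpoints (w ∷ r) e)))
  head-edge-side b h w r u al (inj₂ (there e)) = ⊥-elim (head∉tail u (proj₁ (edge-endpoints (w ∷ r) e)))

  last-edge-side : ∀ b h w r {x} → Unique (h ∷ w ∷ r) → AltFrom b (edgesOf (h ∷ w ∷ r)) →
    OnPath x (lastFrom w r) (h ∷ w ∷ r) → Diff (not (nextSide b (h ∷ w ∷ r))) (lastFrom w r) x
  last-edge-side b h w [] u al (inj₁ (here refl)) rewrite not-involutive b = Diff-sym (alt-head al)
  last-edge-side b h w [] u al (inj₂ (here refl)) = ⊥-elim (head∉tail u (here refl))
  last-edge-side b h w (z ∷ r) u al (inj₁ (here refl)) = ⊥-elim (head∉tail (AllPairs.tail u) (lastFrom∈ z r))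
  last-edge-side b h w (z ∷ r) u al (inj₂ (here refl)) = ⊥-elim (head∉tail u (there (lastFrom∈ z r)))
  last-edge-side b h w (z ∷ r) u al (inj₁ (there e)) = last-edge-side (not b) w z r (AllPairs.tail u) (alt-tail al) (inj₁ e)
  last-edge-side b h w (z ∷ r) u al (inj₂ (there e)) = last-edge-side (not b) w z r (AllPairs.tail u) (alt-tail al) (inj₂ e)

  alt-snoc : ∀ b h r {u} → AltFrom b (edgesOf (h ∷ r)) → Diff (nextSide b (h ∷ r)) (lastFrom h r) u →
    AltFrom b (edgesOf (h ∷ (r ++ u ∷ [])))
  alt-snoc b h [] al d = alt-cons d (alt-nil (not b))
  alt-snoc b h (w ∷ r) al d = alt-cons (alt-head al) (alt-snoc (not b) w r (alt-tail al) d)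

  -- An extension of an alternating path back into itself can only hit the other end, closing an even cycle.
  extension-closes-at-head : ∀ b h w r {u} → Unique (h ∷ w ∷ r) → AltFrom b (edgesOf (h ∷ w ∷ r)) →
    Diff (nextSide b (h ∷ w ∷ r)) (lastFrom w r) u → u ∈ h ∷ w ∷ r → u ≡ h × nextSide b (h ∷ w ∷ r) ≡ not b
  extension-closes-at-head b h w r {u} un al d u∈ with position h (w ∷ r) al u∈
  ... | inj₂ (inj₁ refl) = ⊥-elim (Diff-irrefl d)
  ... | inj₂ (inj₂ int) =
    let (c , on , dc) = int (nextSide b (h ∷ w ∷ r))
        on' = subst (λ z → OnPath u z (h ∷ w ∷ r)) (Diff-functional dc (Diff-sym d)) on
    in ⊥-elim (Diff-exclusive d (last-edge-side b h w r un al on'))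
  ... | inj₁ refl with same-or-flipped (nextSide b (h ∷ w ∷ r)) b
  ...   | inj₂ e = refl , e
  ...   | inj₁ e =
    let d' = subst (λ s → Diff s (lastFrom w r) h) e d
        on = subst (λ z → OnPath h z (h ∷ w ∷ r)) (sym (Diff-functional (Diff-sym d') (alt-head al))) OnPath-first
    in ⊥-elim (Diff-exclusive d (last-edge-side b h w r un al on))

  extension-closes-at-last : ∀ b h w r {u} → Unique (h ∷ w ∷ r) → AltFrom b (edgesOf (h ∷ w ∷ r)) →
    Diff (not b) h u → u ∈ h ∷ w ∷ r → u ≡ lastFrom w r × nextSide b (h ∷ w ∷ r) ≡ not b
  extension-closes-at-last b h w r {u} un al d u∈ with position h (w ∷ r) al u∈
  ... | inj₁ refl = ⊥-elim (Diff-irrefl d)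
  ... | inj₂ (inj₂ int) =
    let (c , on , dc) = int (not b)
        on' = subst (λ z → OnPath u z (h ∷ w ∷ r)) (Diff-functional dc (Diff-sym d)) on
    in ⊥-elim (Diff-exclusive (head-edge-side b h w r un al on') d)
  ... | inj₂ (inj₁ refl) with same-or-flipped (nextSide b (h ∷ w ∷ r)) b
  ...   | inj₂ e = refl , e
  ...   | inj₁ e =
    let (a , on , da) = last-edge b h w r al
        da' = subst (λ s → Diff (not s) (lastFrom w r) a) e da
        on' = subst (λ z → OnPath z (lastFrom w r) (h ∷ w ∷ r)) (Diff-functional da' (Diff-sym d)) on
    in ⊥-elim (Diff-exclusive (head-edge-side b h w r un al (OnPath-sym on')) d)

  close-cycle : ∀ b h w r → Unique (h ∷ w ∷ r) → AltFrom b (edgesOf (h ∷ w ∷ r)) →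
    Diff (nextSide b (h ∷ w ∷ r)) (lastFrom w r) h → nextSide b (h ∷ w ∷ r) ≡ not b → AltCycle X Y (h ∷ w ∷ r)
  close-cycle b h w r un al d e = un , three≤ r al d e , even , AltFrom⇒Alt b (alt-snoc b h (w ∷ r) al d)
    where
    three≤ : ∀ r → AltFrom b (edgesOf (h ∷ w ∷ r)) → Diff (nextSide b (h ∷ w ∷ r)) (lastFrom w r) h →
      nextSide b (h ∷ w ∷ r) ≡ not b → 3 ≤ length (h ∷ w ∷ r)
    three≤ [] al d e = ⊥-elim (Diff-exclusive (Diff-sym (alt-head al)) (subst (λ s → Diff s w h) e d))
    three≤ (_ ∷ _) _ _ _ = s≤s (s≤s (s≤s z≤n))
    even : Even (length (h ∷ w ∷ r))
    even = odd⇒even-suc (nextSide⇒odd b h (w ∷ r) e)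

  maximal⇒ends-stuck : ∀ b h w r → MaxAltPath X Y (h ∷ w ∷ r) → AltFrom b (edgesOf (h ∷ w ∷ r)) →
    Stuck (not b) h × Stuck (nextSide b (h ∷ w ∷ r)) (lastFrom w r)
  maximal⇒ends-stuck b h w r ((un , _ , _) , no-super , no-cycle) al = stuck-head , stuck-last
    where
    p : List V
    p = h ∷ w ∷ r
    stuck-head : Stuck (not b) h
    stuck-head u d with u ∈? p
    ... | no u∉ = no-super (u ∷ p ,
          (∉⇒All≢ p u∉ ∷ un , s≤s z≤n ,
           AltFrom⇒Alt (not b) (alt-cons (Diff-sym d) (subst (λ c → AltFrom c (edgesOf p)) (sym (not-involutive b)) al))) ,
          inj₁ (u ∷ [] , [] , cong (u ∷_) (sym (++-identityʳ p))) , ≤-refl)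
    ... | yes u∈ =
      let (u≡t , e) = extension-closes-at-last b h w r un al d u∈
          d' = subst (λ s → Diff s (lastFrom w r) h) (sym e) (Diff-sym (subst (Diff (not b) h) u≡t d))
      in no-cycle (p , close-cycle b h w r un al d' e , inj₁ ([] , p , refl))
    stuck-last : Stuck (nextSide b p) (lastFrom w r)
    stuck-last u d with u ∈? p
    ... | no u∉ = no-super (p ++ u ∷ [] ,
          (Unique-snoc p un u∉ , s≤s z≤n , AltFrom⇒Alt b (alt-snoc b h (w ∷ r) al d)) ,
          inj₁ ([] , u ∷ [] , refl) , ≤-reflexive (sym (length-snoc p u)))
    ... | yes u∈ =
      let (u≡h , e) = extension-closes-at-head b h w r un al d u∈
      in no-cycle (p , close-cycle b h w r un al (subst (Diff (nextSide b p) (lastFrom w r)) u≡h d) e , inj₁ ([] , p , refl))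

  -- Follow difference edges of alternating sides from v, stopping when stuck or revisiting a vertex;
  -- the fuel n suffices since a repetition-free list of vertices has at most n elements.
  walk : ℕ → Bool → List V → V → List V
  walk zero b visited v = []
  walk (suc fuel) b visited v with any? (Diff? b v)
  ... | no _ = []
  ... | yes (u , _) with u ∈? (v ∷ visited)
  ...   | yes _ = []
  ...   | no _ = u ∷ walk fuel (not b) (v ∷ visited) u

  WalkOutcome : ℕ → Bool → List V → V → List V → Set
  WalkOutcome fuel b visited v rest =
    Stuck (nextSide b (v ∷ rest)) (lastFrom v rest) ⊎
    (∃ λ u → Diff (nextSide b (v ∷ rest)) (lastFrom v rest) u × (u ∈ v ∷ rest ⊎ u ∈ visited)) ⊎
    length rest ≡ fuel

  record WalkSpec (fuel : ℕ) (b : Bool) (visited : List V) (v : V) (rest : List V) : Set where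
    field
      unique      : Unique (v ∷ rest)
      fresh       : All (_∉ visited) (v ∷ rest)
      alternating : AltFrom b (edgesOf (v ∷ rest))
      outcome     : WalkOutcome fuel b visited v rest

  All-∉-∷ : ∀ {v : V} {visited} xs → All (_∉ v ∷ visited) xs → All (_∉ visited) xs × All (v ≢_) xs
  All-∉-∷ [] [] = [] , []
  All-∉-∷ (x ∷ xs) (x∉ ∷ xs∉) =
    let (fresh , ≢v) = All-∉-∷ xs xs∉ in ((x∉ ∘ there) ∷ fresh) , ((λ e → x∉ (here (sym e))) ∷ ≢v)

  walk-spec : ∀ fuel b visited v → v ∉ visited → WalkSpec fuel b visited v (walk fuel b visited v)
  walk-spec zero b visited v v∉ = record
    { unique = [] ∷ [] ; fresh = v∉ ∷ [] ; alternating = alt-nil b ; outcome = inj₂ (inj₂ refl) }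
  walk-spec (suc fuel) b visited v v∉ with any? (Diff? b v)
  ... | no none = record
    { unique = [] ∷ [] ; fresh = v∉ ∷ [] ; alternating = alt-nil b ; outcome = inj₁ (λ u d → none (u , d)) }
  ... | yes (u , d) with u ∈? (v ∷ visited)
  ...   | yes (here e) = record
    { unique = [] ∷ [] ; fresh = v∉ ∷ [] ; alternating = alt-nil b ; outcome = inj₂ (inj₁ (u , d , inj₁ (here e))) }
  ...   | yes (there u∈) = record
    { unique = [] ∷ [] ; fresh = v∉ ∷ [] ; alternating = alt-nil b ; outcome = inj₂ (inj₁ (u , d , inj₂ u∈)) }
  ...   | no u∉ = record
    { unique = ≢v ∷ unique ; fresh = v∉ ∷ fresh′ ; alternating = alt-cons d alternating ; outcome = extend outcome }
    where
    open WalkSpec (walk-spec fuel (not b) (v ∷ visited) u u∉)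
    fresh′ = proj₁ (All-∉-∷ _ fresh)
    ≢v = proj₂ (All-∉-∷ _ fresh)
    rest = walk fuel (not b) (v ∷ visited) u
    extend : WalkOutcome fuel (not b) (v ∷ visited) u rest → WalkOutcome (suc fuel) b visited v (u ∷ rest)
    extend (inj₁ stuck) = inj₁ stuck
    extend (inj₂ (inj₂ e)) = inj₂ (inj₂ (cong suc e))
    extend (inj₂ (inj₁ (x , d , inj₁ x∈))) = inj₂ (inj₁ (x , d , inj₁ (there x∈)))
    extend (inj₂ (inj₁ (x , d , inj₂ (here e)))) = inj₂ (inj₁ (x , d , inj₁ (here e)))
    extend (inj₂ (inj₁ (x , d , inj₂ (there x∈)))) = inj₂ (inj₁ (x , d , inj₂ x∈))

  trail : Bool → V → List V
  trail b v = walk n b [] v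

  pathFrom : Bool → V → List V
  pathFrom b v = v ∷ trail b v

  trail-spec : ∀ b v → WalkSpec n b [] v (trail b v)
  trail-spec b v = walk-spec n b [] v (λ ())

  Endpoint : Bool → V → Set
  Endpoint b v = (∃ λ u → Diff b v u) × Stuck (not b) v

  trail-ends-stuck : ∀ b v → Stuck (not b) v → Stuck (nextSide b (pathFrom b v)) (lastFrom v (trail b v))
  trail-ends-stuck b v stuck with WalkSpec.outcome (trail-spec b v)
  ... | inj₁ stuck-last = stuck-last
  ... | inj₂ (inj₂ len≡n) = ⊥-elim (<-irrefl refl (≤-trans (≤-reflexive (cong suc (sym len≡n)))
                                                            (unique-length≤ (pathFrom b v) (WalkSpec.unique (trail-spec b v)))))
  ... | inj₂ (inj₁ (u , d , inj₂ ()))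
  ... | inj₂ (inj₁ (u , d , inj₁ u∈)) = closes (trail b v) (WalkSpec.unique (trail-spec b v)) (WalkSpec.alternating (trail-spec b v)) d u∈
    where
    closes : ∀ rest → Unique (v ∷ rest) → AltFrom b (edgesOf (v ∷ rest)) →
      Diff (nextSide b (v ∷ rest)) (lastFrom v rest) u → u ∈ v ∷ rest → Stuck (nextSide b (v ∷ rest)) (lastFrom v rest)
    closes [] _ _ d (here refl) = ⊥-elim (Diff-irrefl d)
    closes (w ∷ r) un al d u∈ =
      let (u≡v , e) = extension-closes-at-head b v w r un al d u∈
          d' = subst (λ s → Diff s (lastFrom w r) v) e (subst (Diff (nextSide b (v ∷ w ∷ r)) (lastFrom w r)) u≡v d)
      in ⊥-elim (stuck _ (Diff-sym d'))

  trail-nonempty : ∀ b v → Endpoint b v → ∃₂ λ w r → trail b v ≡ w ∷ r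
  trail-nonempty b v ((u , d) , stuck) with trail b v | trail-ends-stuck b v stuck
  ... | [] | stuck-last = ⊥-elim (stuck-last u d)
  ... | w ∷ r | _ = w , r , refl

  stuck-alternating-unique : ∀ b h r r' → AltFrom b (edgesOf (h ∷ r)) → AltFrom b (edgesOf (h ∷ r')) →
    Stuck (nextSide b (h ∷ r)) (lastFrom h r) → Stuck (nextSide b (h ∷ r')) (lastFrom h r') → r ≡ r'
  stuck-alternating-unique b h [] [] _ _ _ _ = refl
  stuck-alternating-unique b h [] (w ∷ r') _ al' stuck _ = ⊥-elim (stuck w (alt-head al'))
  stuck-alternating-unique b h (w ∷ r) [] al _ _ stuck' = ⊥-elim (stuck' w (alt-head al))
  stuck-alternating-unique b h (w ∷ r) (w' ∷ r') al al' stuck stuck' with Diff-functional (alt-head al) (alt-head al')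
  ... | refl = cong (w ∷_) (stuck-alternating-unique (not b) w r r' (alt-tail al) (alt-tail al') stuck stuck')

  cycle-start-both-sides : ∀ b c0 c1 cr → Even (length (c0 ∷ c1 ∷ cr)) → AltFrom b (edgesOf (c0 ∷ (c1 ∷ cr ++ c0 ∷ []))) →
    ∀ s → ∃ λ a → Diff s c0 a
  cycle-start-both-sides b c0 c1 cr even al s with nextSide-parity b c0 (c1 ∷ cr ++ c0 ∷ [])
  ... | inj₂ (_ , odd) = ⊥-elim (¬even∧odd even (subst Odd (cong suc (length-snoc cr c0)) odd))
  ... | inj₁ (e , _) with same-or-flipped s b | last-edge b c0 c1 (cr ++ c0 ∷ []) al
  ...   | inj₁ refl | _ = c1 , alt-head al
  ...   | inj₂ refl | (a , _ , da) =
    a , subst (λ z → Diff (not b) z a) (lastFrom-snoc c1 cr c0) (subst (λ z → Diff (not z) (lastFrom c1 (cr ++ c0 ∷ [])) a) e da)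

  cycle-vertex-both-sides : ∀ c → AltCycle X Y c → ∀ {x} → x ∈ c → ∀ s → ∃ λ a → Diff s x a
  cycle-vertex-both-sides (_ ∷ []) (_ , s≤s () , _) _ _
  cycle-vertex-both-sides (c0 ∷ c1 ∷ cr) (un , _ , even , alt) {x} x∈ s with Alt⇒AltFrom alt
  ... | (b , al) with position c0 ((c1 ∷ cr) ++ c0 ∷ []) al (∈-++⁺ˡ x∈)
  ...   | inj₂ (inj₂ int) = let (a , _ , d) = int s in a , d
  ...   | inj₁ refl = cycle-start-both-sides b c0 c1 cr even al s
  ...   | inj₂ (inj₁ e) = subst (λ z → ∃ λ a → Diff s z a) (sym (trans e (lastFrom-snoc c1 cr c0)))
                                (cycle-start-both-sides b c0 c1 cr even al s)

  -- A stuck endpoint of p cannot be interior to an alternating path or cycle, so every alternating path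
  -- containing p has both of p's endpoints as its own ends.
  ends-stuck⇒maximal : ∀ b h w r → Unique (h ∷ w ∷ r) → AltFrom b (edgesOf (h ∷ w ∷ r)) →
    Stuck (not b) h → Stuck (nextSide b (h ∷ w ∷ r)) (lastFrom w r) → MaxAltPath X Y (h ∷ w ∷ r)
  ends-stuck⇒maximal b h w r un al stuck-head stuck-last = (un , s≤s z≤n , AltFrom⇒Alt b al) , no-super , no-cycle
    where
    p : List V
    p = h ∷ w ∷ r
    h≢t : h ≢ lastFrom w r
    h≢t e = head∉tail un (subst (_∈ w ∷ r) (sym e) (lastFrom∈ w r))
    no-super : ¬ (∃ λ q → AltPath X Y q × ProperSubpath p q)
    no-super ([] , _ , inf , _) with oriented-infix inf
    ... | (p' , i , ⊆p' , _) with Infix⇒⊆ i (⊆p' {h} (here refl))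
    ... | ()
    no-super (h' ∷ r' , (uq , _ , aq) , inf , shorter) with oriented-infix inf | Alt⇒AltFrom aq
    ... | (p' , (xs , ys , eq) , ⊆p' , len) | (b' , aq') =
      <-irrefl refl (subst (λ z → length p < z) (trans (infix-containing-ends p' xs ys h' r' eq uq h'∈ t'∈) len) shorter)
      where
      end-of-q : ∀ x s → x ∈ p → Stuck s x → x ≡ h' ⊎ x ≡ lastFrom h' r'
      end-of-q x s x∈ stuck with position h' r' aq' (Infix⇒⊆ (xs , ys , eq) (⊆p' x∈))
      ... | inj₁ e = inj₁ e
      ... | inj₂ (inj₁ e) = inj₂ e
      ... | inj₂ (inj₂ int) = let (c , _ , d) = int s in ⊥-elim (stuck c d)
      ends∈ : (h' ∈ p') × (lastFrom h' r' ∈ p')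
      ends∈ with end-of-q h (not b) (here refl) stuck-head | end-of-q (lastFrom w r) (nextSide b p) (there (lastFrom∈ w r)) stuck-last
      ... | inj₁ e1 | inj₁ e2 = ⊥-elim (h≢t (trans e1 (sym e2)))
      ... | inj₁ e1 | inj₂ e2 = subst (_∈ p') e1 (⊆p' (here refl)) , subst (_∈ p') e2 (⊆p' (there (lastFrom∈ w r)))
      ... | inj₂ e1 | inj₁ e2 = subst (_∈ p') e2 (⊆p' (there (lastFrom∈ w r))) , subst (_∈ p') e1 (⊆p' (here refl))
      ... | inj₂ e1 | inj₂ e2 = ⊥-elim (h≢t (trans e1 (sym e2)))
      h'∈ = proj₁ ends∈
      t'∈ = proj₂ ends∈
    no-cycle : ¬ (∃ λ c → AltCycle X Y c × SubpathOfCycle p c)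
    no-cycle (c , cyc , sub) = let (a , d) = cycle-vertex-both-sides c cyc (SubpathOfCycle⇒⊆ c sub (here refl)) (not b) in stuck-head a d

  reverse-alternating : ∀ b h r → AltFrom b (edgesOf (h ∷ r)) →
    let s = not (nextSide b (h ∷ r)) in
    AltFrom s (edgesOf (reverse (h ∷ r))) × nextSide s (reverse (h ∷ r)) ≡ not b
  reverse-alternating b h [] al = alt-nil (not b) , refl
  reverse-alternating b h (w ∷ r) al =
    let s = not (nextSide b (h ∷ w ∷ r))
        (al' , e) = reverse-alternating (not b) w r (alt-tail al)
        (r' , eR) = reverse-shape w r
        t = lastFrom w r
        al'' : AltFrom s (edgesOf (t ∷ r'))
        al'' = subst (AltFrom s ∘ edgesOf) eR al'
        e' : nextSide s (t ∷ r') ≡ b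
        e' = trans (subst (λ R → nextSide s R ≡ not (not b)) eR e) (not-involutive b)
        t-last : lastFrom t r' ≡ w
        t-last = trans (cong (lastFrom h) (sym eR)) (lastFrom-reverse h w r)
        d : Diff (nextSide s (t ∷ r')) (lastFrom t r') h
        d = subst₂ (λ s z → Diff s z h) (sym e') (sym t-last) (Diff-sym (alt-head al))
        Goal : List V → Set
        Goal R = AltFrom s (edgesOf R) × nextSide s R ≡ not b
    in subst Goal (sym (trans (unfold-reverse h (w ∷ r)) (cong (_++ h ∷ []) eR)))
         (alt-snoc s t r' al'' d , trans (nextSide-snoc s t r' h) (cong not e'))

  far : Bool → V → V
  far b v = lastFrom v (trail b v)

  trail-of-reversal : ∀ b v w r → AltFrom b (edgesOf (v ∷ w ∷ r)) →
    Stuck (not b) v → Stuck (nextSide b (v ∷ w ∷ r)) (lastFrom w r) →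
    let s = not (nextSide b (v ∷ w ∷ r)) ; t = lastFrom w r in
    Endpoint s t × far s t ≡ v × nextSide s (pathFrom s t) ≡ not b
  trail-of-reversal b v w r al stuck-head stuck-last =
    let s = not (nextSide b (v ∷ w ∷ r))
        t = lastFrom w r
        (r' , eR) = reverse-shape v (w ∷ r)
        (alR , nsR) = reverse-alternating b v (w ∷ r) al
        (a , _ , da) = last-edge b v w r al
        stuck-t : Stuck (not s) t
        stuck-t = subst (λ z → Stuck z t) (sym (not-involutive _)) stuck-last
        alR' : AltFrom s (edgesOf (t ∷ r'))
        alR' = subst (AltFrom s ∘ edgesOf) eR alR
        nsR' : nextSide s (t ∷ r') ≡ not b
        nsR' = subst (λ z → nextSide s z ≡ not b) eR nsR
        lastR : lastFrom t r' ≡ v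
        lastR = trans (cong (lastFrom t) (sym eR)) (lastFrom-reverse t v (w ∷ r))
        stuckR : Stuck (nextSide s (t ∷ r')) (lastFrom t r')
        stuckR = subst₂ Stuck (sym nsR') (sym lastR) stuck-head
        trail≡ : trail s t ≡ r'
        trail≡ = stuck-alternating-unique s t (trail s t) r' (WalkSpec.alternating (trail-spec s t)) alR'
                   (trail-ends-stuck s t stuck-t) stuckR
    in ((a , da) , stuck-t) , trans (cong (lastFrom t) trail≡) lastR ,
       trans (cong (λ z → nextSide s (t ∷ z)) trail≡) nsR'

  far-end : ∀ b v → Endpoint b v →
    let s = not (nextSide b (pathFrom b v)) in
    Endpoint s (far b v) × far s (far b v) ≡ v × nextSide s (pathFrom s (far b v)) ≡ not b
  far-end b v ((u , d) , stuck) with trail b v | WalkSpec.alternating (trail-spec b v) | trail-ends-stuck b v stuck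
  ... | [] | _ | stuck-last = ⊥-elim (stuck-last u d)
  ... | w ∷ r | al | stuck-last = trail-of-reversal b v w r al stuck stuck-last

  Stuck? : ∀ b t → Dec (Stuck b t)
  Stuck? b t with any? (Diff? b t)
  ... | yes (u , d) = no (λ stuck → stuck u d)
  ... | no none = yes (λ u d → none (u , d))

  Endpoint? : ∀ b v → Dec (Endpoint b v)
  Endpoint? b v = any? (Diff? b v) ×-dec Stuck? (not b) v

  Endpoint-exclusive : ∀ {v} → Endpoint true v → ¬ Endpoint false v
  Endpoint-exclusive (_ , stuck) ((u , d) , _) = stuck u d

  -- The other end of the maximal alternating path ending at v, and v itself if v is no endpoint.
  opposite : V → V
  opposite v with Endpoint? true v | Endpoint? false v
  ... | yes _ | _ = far true v
  ... | no _ | yes _ = far false v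
  ... | no _ | no _ = v

  opposite-Endpoint : ∀ b v → Endpoint b v → opposite v ≡ far b v
  opposite-Endpoint true v e with Endpoint? true v | Endpoint? false v
  ... | yes _ | _ = refl
  ... | no ¬e | _ = ⊥-elim (¬e e)
  opposite-Endpoint false v e with Endpoint? true v | Endpoint? false v
  ... | yes e' | _ = ⊥-elim (Endpoint-exclusive e' e)
  ... | no _ | yes _ = refl
  ... | no _ | no ¬e = ⊥-elim (¬e e)

  opposite-non-Endpoint : ∀ v → ¬ Endpoint true v → ¬ Endpoint false v → opposite v ≡ v
  opposite-non-Endpoint v ¬e ¬e' with Endpoint? true v | Endpoint? false v
  ... | yes e | _ = ⊥-elim (¬e e)
  ... | no _ | yes e = ⊥-elim (¬e' e)
  ... | no _ | no _ = refl

  opposite-involutive : ∀ v → opposite (opposite v) ≡ v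
  opposite-involutive v = by-cases (Endpoint? true v) (Endpoint? false v)
    where
    via : ∀ b → Endpoint b v → opposite (opposite v) ≡ v
    via b e = let (e' , far≡v , _) = far-end b v e in
      trans (cong opposite (opposite-Endpoint b v e)) (trans (opposite-Endpoint _ _ e') far≡v)
    by-cases : Dec (Endpoint true v) → Dec (Endpoint false v) → opposite (opposite v) ≡ v
    by-cases (yes e) _ = via true e
    by-cases (no _) (yes e) = via false e
    by-cases (no ¬e) (no ¬e') = trans (cong opposite (opposite-non-Endpoint v ¬e ¬e')) (opposite-non-Endpoint v ¬e ¬e')

  opposite-moves : ∀ b v → Endpoint b v → opposite v ≢ v
  opposite-moves b v e opp≡v with trail-nonempty b v e
  ... | (w , r , eq) =
    let un = subst (λ z → Unique (v ∷ z)) eq (WalkSpec.unique (trail-spec b v))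
        far≡ = trans (sym (opposite-Endpoint b v e)) opp≡v
    in head∉tail un (subst (_∈ w ∷ r) (trans (sym (cong (lastFrom v) eq)) far≡) (lastFrom∈ w r))

  OddEnd EvenEnd : Bool → V → Set
  OddEnd b v = Endpoint b v × nextSide b (pathFrom b v) ≡ not b
  EvenEnd b v = Endpoint b v × nextSide b (pathFrom b v) ≡ b

  OddEnd? : ∀ b v → Dec (OddEnd b v)
  OddEnd? b v = Endpoint? b v ×-dec (nextSide b (pathFrom b v) ≟ᵇ not b)

  EvenEnd? : ∀ b v → Dec (EvenEnd b v)
  EvenEnd? b v = Endpoint? b v ×-dec (nextSide b (pathFrom b v) ≟ᵇ b)

  OddEnd-opposite : ∀ b v → OddEnd b v → OddEnd b (opposite v)
  OddEnd-opposite b v (e , odd) =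
    let (e' , _ , ns') = far-end b v e
        s≡b = trans (cong not odd) (not-involutive b)
    in subst (OddEnd b) (sym (opposite-Endpoint b v e))
         (subst (λ c → Endpoint c (far b v)) s≡b e' , subst (λ c → nextSide c (pathFrom c (far b v)) ≡ not b) s≡b ns')

  EvenEnd-opposite : ∀ b v → EvenEnd b v → EvenEnd (not b) (opposite v)
  EvenEnd-opposite b v (e , even) =
    let (e' , _ , ns') = far-end b v e
        s≡nb = cong not even
    in subst (EvenEnd (not b)) (sym (opposite-Endpoint b v e))
         (subst (λ c → Endpoint c (far b v)) s≡nb e' ,
          subst (λ c → nextSide c (pathFrom c (far b v)) ≡ c) s≡nb (trans ns' (sym s≡nb)))

  OddEnd-opposite⁻ : ∀ b v → OddEnd b (opposite v) → OddEnd b v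
  OddEnd-opposite⁻ b v odd = subst (OddEnd b) (opposite-involutive v) (OddEnd-opposite b (opposite v) odd)

  EvenEnd-opposite⁻ : ∀ v → EvenEnd true (opposite v) → EvenEnd false v
  EvenEnd-opposite⁻ v even = subst (EvenEnd false) (opposite-involutive v) (EvenEnd-opposite true (opposite v) even)

  canonical : Bool → V → Bool
  canonical b v = does (OddEnd? b v) ∧ before v (opposite v)

  -- Each odd path is counted once by canonical, at its end with the smaller index.
  #oddEnds≡2#canonical : ∀ b → # (does ∘ OddEnd? b) ≡ # (canonical b) + # (canonical b)
  #oddEnds≡2#canonical b = begin
    # (does ∘ OddEnd? b)
      ≡⟨ sum-cong-≗ split ⟩
    ∑ (λ v → 𝟙 (canonical b v) + 𝟙 (does (OddEnd? b v) ∧ before (opposite v) v))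
      ≡⟨ ∑-distrib-+ (𝟙 ∘ canonical b) (λ v → 𝟙 (does (OddEnd? b v) ∧ before (opposite v) v)) ⟩
    # (canonical b) + ∑ (λ v → 𝟙 (does (OddEnd? b v) ∧ before (opposite v) v))
      ≡⟨ cong (# (canonical b) +_) (trans (sym (sum-cong-≗ reindex)) (∑-involution opposite opposite-involutive _)) ⟩
    # (canonical b) + # (canonical b) ∎
    where
    open ≡-Reasoning
    reindex : ∀ v → 𝟙 (canonical b (opposite v)) ≡ 𝟙 (does (OddEnd? b v) ∧ before (opposite v) v)
    reindex v = cong₂ (λ x y → 𝟙 (x ∧ y))
      (does-⇔ (mk⇔ (OddEnd-opposite⁻ b v) (OddEnd-opposite b v)) (OddEnd? b (opposite v)) (OddEnd? b v))
      (cong (before (opposite v)) (opposite-involutive v))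
    split : ∀ v → 𝟙 (does (OddEnd? b v)) ≡ 𝟙 (canonical b v) + 𝟙 (does (OddEnd? b v) ∧ before (opposite v) v)
    split v = by-cases (OddEnd? b v)
      where
      by-cases : (odd? : Dec (OddEnd b v)) →
        𝟙 (does odd?) ≡ 𝟙 (does odd? ∧ before v (opposite v)) + 𝟙 (does odd? ∧ before (opposite v) v)
      by-cases (no _) = refl
      by-cases (yes (e , _)) with before-trichotomy v (opposite v)
      ... | inj₁ (v<o , o≮v) rewrite v<o | o≮v = refl
      ... | inj₂ (inj₁ (v≮o , o<v)) rewrite v≮o | o<v = refl
      ... | inj₂ (inj₂ v≡o) = ⊥-elim (opposite-moves b v e (sym v≡o))

  #evenEnds-balanced : # (does ∘ EvenEnd? true) ≡ # (does ∘ EvenEnd? false)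
  #evenEnds-balanced = trans (sym (∑-involution opposite opposite-involutive (𝟙 ∘ does ∘ EvenEnd? true)))
    (sum-cong-≗ λ v → cong 𝟙 (does-⇔ (mk⇔ (EvenEnd-opposite⁻ v) (EvenEnd-opposite false v)) (EvenEnd? true (opposite v)) (EvenEnd? false v)))

  Endpoint-parity-split : ∀ b v → 𝟙 (does (Endpoint? b v)) ≡ 𝟙 (does (OddEnd? b v)) + 𝟙 (does (EvenEnd? b v))
  Endpoint-parity-split b v = split (does (Endpoint? b v)) (nextSide b (pathFrom b v)) b
    where
    split : ∀ e s b → 𝟙 e ≡ 𝟙 (e ∧ does (s ≟ᵇ not b)) + 𝟙 (e ∧ does (s ≟ᵇ b))
    split false _ _ = refl
    split true true true = refl
    split true true false = refl
    split true false true = refl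
    split true false false = refl

  Endpoint⇔covered : ∀ b v → Endpoint b v ⇔ (Covered (side b) v × ¬ Covered (side (not b)) v)
  Endpoint⇔covered b v = mk⇔ to from
    where
    to : Endpoint b v → Covered (side b) v × ¬ Covered (side (not b)) v
    to ((u , d) , stuck) = (u , on-side d) , λ (c , on-c) → case-other c on-c (side b v c) refl
      where
      case-other : ∀ c → side (not b) v c ≡ true → ∀ x → side b v c ≡ x → ⊥
      case-other c on-c true on = true≢false (trans (sym on-c)
        (subst (λ z → side (not b) v z ≡ false) (functional (side-matching b) v u c (on-side d) on) (off-side d)))
      case-other c on-c false off = stuck c (diff on-c (subst (λ s → side s v c ≡ false) (sym (not-involutive b)) off))
    from : Covered (side b) v × ¬ Covered (side (not b)) v → Endpoint b v
    from ((a , on) , uncovered) =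
      (a , diff on (¬-not (λ on' → uncovered (a , on')))) , λ u d → uncovered (u , on-side d)

  degree-balance : ∀ v → degree Y v + 𝟙 (does (Endpoint? true v)) ≡ degree X v + 𝟙 (does (Endpoint? false v))
  degree-balance v = begin
    degree Y v + 𝟙 (does (Endpoint? true v))
      ≡⟨ cong₂ _+_ (degree≡𝟙covered Y-matching v) (cong 𝟙 (endpoint≡ true)) ⟩
    𝟙 cy + 𝟙 (cx ∧ not cy)
      ≡⟨ 𝟙-identity cx cy ⟩
    𝟙 cx + 𝟙 (cy ∧ not cx)
      ≡⟨ sym (cong₂ _+_ (degree≡𝟙covered X-matching v) (cong 𝟙 (endpoint≡ false))) ⟩
    degree X v + 𝟙 (does (Endpoint? false v)) ∎
    where
    open ≡-Reasoning
    cx = does (covered? X v)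
    cy = does (covered? Y v)
    endpoint≡ : ∀ b → does (Endpoint? b v) ≡ does (covered? (side b) v) ∧ not (does (covered? (side (not b)) v))
    endpoint≡ b = does-⇔ (Endpoint⇔covered b v) (Endpoint? b v) (covered? (side b) v ×-dec ¬? (covered? (side (not b)) v))
    𝟙-identity : ∀ x y → 𝟙 y + 𝟙 (x ∧ not y) ≡ 𝟙 x + 𝟙 (y ∧ not x)
    𝟙-identity true true = refl
    𝟙-identity true false = refl
    𝟙-identity false true = refl
    𝟙-identity false false = refl

  -- Summing degree-balance over all vertices, the even paths cancel in pairs and only odd ones remain.
  count-balance : size Y + size Y + # (does ∘ OddEnd? true) ≡ size X + size X + # (does ∘ OddEnd? false)
  count-balance = +-cancelʳ-≡ (# (does ∘ EvenEnd? true)) _ _ (begin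
    (size Y + size Y + oddT) + evenT
      ≡⟨ +-assoc (size Y + size Y) oddT evenT ⟩
    (size Y + size Y) + (oddT + evenT)
      ≡⟨ cong₂ _+_ (sym (handshake Y-matching)) (sym (endpoints true)) ⟩
    ∑ (degree Y) + # (does ∘ Endpoint? true)
      ≡⟨ sym (∑-distrib-+ (degree Y) (𝟙 ∘ does ∘ Endpoint? true)) ⟩
    ∑ (λ v → degree Y v + 𝟙 (does (Endpoint? true v)))
      ≡⟨ sum-cong-≗ degree-balance ⟩
    ∑ (λ v → degree X v + 𝟙 (does (Endpoint? false v)))
      ≡⟨ ∑-distrib-+ (degree X) (𝟙 ∘ does ∘ Endpoint? false) ⟩
    ∑ (degree X) + # (does ∘ Endpoint? false)
      ≡⟨ cong₂ _+_ (handshake X-matching) (endpoints false) ⟩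
    (size X + size X) + (oddF + evenF)
      ≡⟨ cong (λ z → (size X + size X) + (oddF + z)) (sym #evenEnds-balanced) ⟩
    (size X + size X) + (oddF + evenT)
      ≡⟨ sym (+-assoc (size X + size X) oddF evenT) ⟩
    (size X + size X + oddF) + evenT ∎)
    where
    open ≡-Reasoning
    oddT = # (does ∘ OddEnd? true)
    evenT = # (does ∘ EvenEnd? true)
    oddF = # (does ∘ OddEnd? false)
    evenF = # (does ∘ EvenEnd? false)
    endpoints : ∀ b → # (does ∘ Endpoint? b) ≡ # (does ∘ OddEnd? b) + # (does ∘ EvenEnd? b)
    endpoints b = trans (sum-cong-≗ (Endpoint-parity-split b)) (∑-distrib-+ (𝟙 ∘ does ∘ OddEnd? b) (𝟙 ∘ does ∘ EvenEnd? b))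

  OddMaxPath : Bool → List V → Set
  OddMaxPath b p = MaxAltPath X Y p × AltFrom b (edgesOf p) × Odd (length (edgesOf p)) × Canonical p

  OddMaxPath⇒pathFrom : ∀ b p → MaxAltPath X Y p → AltFrom b (edgesOf p) → Odd (length (edgesOf p)) →
    ∃ λ h → p ≡ pathFrom b h × OddEnd b h
  OddMaxPath⇒pathFrom b [] ((_ , () , _) , _) _ _
  OddMaxPath⇒pathFrom b (h ∷ []) ((_ , () , _) , _) _ _
  OddMaxPath⇒pathFrom b (h ∷ w ∷ r) max al odd =
    let (stuck-head , stuck-last) = maximal⇒ends-stuck b h w r max al
        trail≡ = stuck-alternating-unique b h (w ∷ r) (trail b h) al (WalkSpec.alternating (trail-spec b h))
                   stuck-last (trail-ends-stuck b h stuck-head)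
        ns≡ = odd⇒nextSide b h (w ∷ r) (subst Odd (length-edgesOf h (w ∷ r)) odd)
    in h , cong (h ∷_) trail≡ , ((w , alt-head al) , stuck-head) , subst (λ z → nextSide b (h ∷ z) ≡ not b) trail≡ ns≡

  OddEnd⇒OddMaxPath : ∀ b v → OddEnd b v → toℕ v < toℕ (far b v) → OddMaxPath b (pathFrom b v)
  OddEnd⇒OddMaxPath b v (e , odd) v<far with trail b v | WalkSpec.unique (trail-spec b v) | WalkSpec.alternating (trail-spec b v)
                                         | trail-ends-stuck b v (proj₂ e) | trail-nonempty b v e
  ... | w ∷ r | un | al | stuck-last | _ =
    ends-stuck⇒maximal b v w r un al (proj₂ e) stuck-last , al ,
    subst Odd (sym (length-edgesOf v (w ∷ r))) (nextSide⇒odd b v (w ∷ r) odd) ,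
    subst (toℕ v <_) (sym (last?≡lastFrom v (w ∷ r))) v<far

  canonicalPaths : Bool → List (List V)
  canonicalPaths b = map (pathFrom b) (filter (λ v → canonical b v ≟ᵇ true) (allFin n))

  canonical⇒OddEnd : ∀ {b v} → canonical b v ≡ true → OddEnd b v × toℕ v < toℕ (opposite v)
  canonical⇒OddEnd {b} {v} = by-cases (OddEnd? b v) (before v (opposite v)) refl
    where
    by-cases : (odd? : Dec (OddEnd b v)) (x : Bool) → before v (opposite v) ≡ x →
      does odd? ∧ x ≡ true → OddEnd b v × toℕ v < toℕ (opposite v)
    by-cases (yes odd) true v<o _ = odd , before⇒< v<o

  canonicalPaths-sound : ∀ b p → p ∈ canonicalPaths b → OddMaxPath b p
  canonicalPaths-sound b p p∈ with ∈-map⁻ (pathFrom b) p∈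
  ... | (v , v∈ , refl) =
    let (odd , v<o) = canonical⇒OddEnd (proj₂ (∈-filter⁻ (λ v → canonical b v ≟ᵇ true) {xs = allFin n} v∈))
    in OddEnd⇒OddMaxPath b v odd (subst (λ z → toℕ v < toℕ z) (opposite-Endpoint b v (proj₁ odd)) v<o)

  canonicalPaths-complete : ∀ b p → OddMaxPath b p → p ∈ canonicalPaths b
  canonicalPaths-complete b p (max , al , odd , can) with OddMaxPath⇒pathFrom b p max al odd
  ... | (h , refl , oddEnd) = ∈-map⁺ (pathFrom b) (∈-filter⁺ (λ v → canonical b v ≟ᵇ true) (∈-allFin h) can′)
    where
    v<o : toℕ h < toℕ (opposite h)
    v<o = subst (toℕ h <_) (trans (last?≡lastFrom h (trail b h)) (cong toℕ (sym (opposite-Endpoint b h (proj₁ oddEnd))))) can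
    can′ : canonical b h ≡ true
    can′ rewrite dec-true (OddEnd? b h) oddEnd = <⇒before v<o

  card-OddMaxPath : ∀ b → Card (OddMaxPath b) (# (canonical b))
  card-OddMaxPath b =
    canonicalPaths b ,
    map⁺ ∷-injectiveˡ (filter⁺ (λ v → canonical b v ≟ᵇ true) (allFin⁺ n)) ,
    canonicalPaths-sound b , canonicalPaths-complete b ,
    trans (length-map (pathFrom b) (filter (λ v → canonical b v ≟ᵇ true) (allFin n))) (length-filter-tabulate (canonical b) id)

  opaque
    OnPath? : ∀ (x y : V) p → Dec (OnPath x y p)
    OnPath? x y p = ((x , y) ∈ₑ? edgesOf p) ⊎-dec ((y , x) ∈ₑ? edgesOf p)

  odd-path-partner : ∀ b h w r {x} → AltFrom b (edgesOf (h ∷ w ∷ r)) → nextSide b (h ∷ w ∷ r) ≡ not b →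
    x ∈ h ∷ w ∷ r → ∃ λ a → OnPath x a (h ∷ w ∷ r) × Diff b x a
  odd-path-partner b h w r al odd x∈ with position h (w ∷ r) al x∈
  ... | inj₁ refl = w , OnPath-first , alt-head al
  ... | inj₂ (inj₁ refl) = let (a , on , d) = last-edge b h w r al in
        a , OnPath-sym on , subst (λ c → Diff c (lastFrom w r) a) (trans (cong not odd) (not-involutive b)) d
  ... | inj₂ (inj₂ int) = int b

  -- Along an odd path with both ends on side b, exchanging the path's edges turns side (not b)
  -- into a matching with one more edge.
  module Augmentation (b : Bool) (h w : V) (r : List V) (un : Unique (h ∷ w ∷ r))
    (al : AltFrom b (edgesOf (h ∷ w ∷ r))) (stuck-head : Stuck (not b) h) (stuck-last : Stuck (not b) (lastFrom w r))
    (odd : nextSide b (h ∷ w ∷ r) ≡ not b) where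

    p : List V
    p = h ∷ w ∷ r

    t : V
    t = lastFrom w r

    S : EdgeSet n
    S = side (not b)

    S-matching : IsMatchingSet S
    S-matching = side-matching (not b)

    flipped : EdgeSet n
    flipped i j = S i j xor does (OnPath? i j p)

    path-partner : ∀ {x} → x ∈ p → ∃ λ a → OnPath x a p × Diff b x a
    path-partner = odd-path-partner b h w r al odd

    S⇒Diff : ∀ {x j} → S x j ≡ true → side b x j ≡ false → Diff (not b) x j
    S⇒Diff Txj off = diff Txj (subst (λ c → side c _ _ ≡ false) (sym (not-involutive b)) off)

    S-shared-edge : ∀ {x a j} → Diff b x a → S x j ≡ true → side b x j ≡ true → j ≡ a
    S-shared-edge d _ on = functional (side-matching b) _ _ _ on (on-side d)

    off-path : ∀ {x} → x ∉ p → ∀ j → does (OnPath? x j p) ≡ false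
    off-path x∉ j = dec-false (OnPath? _ j p) (λ on → x∉ (proj₁ (OnPath-endpoints p on)))

    flipped-off-path : ∀ {x} → x ∉ p → ∀ j → flipped x j ≡ S x j
    flipped-off-path {x} x∉ j = trans (cong (S x j xor_) (off-path x∉ j)) (xor-identityʳ (S x j))

    flipped-on-path : ∀ {x} (x∈ : x ∈ p) → ∀ j → flipped x j ≡ true → j ≡ proj₁ (path-partner x∈)
    flipped-on-path {x} x∈ j = by-cases (path-partner x∈) (OnPath? x j p)
      where
      at : x ≡ h ⊎ x ≡ t ⊎ Interior x p → ¬ OnPath x j p → ¬ Diff (not b) x j
      at (inj₁ refl) _ d = stuck-head j d
      at (inj₂ (inj₁ refl)) _ d = stuck-last j d
      at (inj₂ (inj₂ int)) ¬on d = let (c , on , dc) = int (not b) in ¬on (subst (λ z → OnPath x z p) (Diff-functional dc d) on)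
      by-cases : (partner : ∃ λ a → OnPath x a p × Diff b x a) (on? : Dec (OnPath x j p)) →
        S x j xor does on? ≡ true → j ≡ proj₁ partner
      by-cases (a , _ , da) (yes on) flip with OnPath-Diff b p al on
      ... | inj₁ d = Diff-functional d da
      ... | inj₂ d = ⊥-elim (true≢false (trans (sym flip) (cong (_xor true) (on-side d))))
      by-cases (a , _ , da) (no ¬on) flip with side b x j in on-b
      ... | true = S-shared-edge da (trans (sym (xor-identityʳ (S x j))) flip) on-b
      ... | false = ⊥-elim (at (position h (w ∷ r) al x∈) ¬on (S⇒Diff (trans (sym (xor-identityʳ (S x j))) flip) on-b))

    flipped-partner : ∀ {x} (x∈ : x ∈ p) → flipped x (proj₁ (path-partner x∈)) ≡ true
    flipped-partner {x} x∈ with path-partner x∈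
    ... | (a , on , da) rewrite off-side da | dec-true (OnPath? x a p) on = refl

    degree-flipped-on-path : ∀ {x} → x ∈ p → degree flipped x ≡ 1
    degree-flipped-on-path {x} x∈ =
      trans (∑-concentrated (proj₁ (path-partner x∈)) (λ j → 𝟙 (flipped x j)) others) (cong 𝟙 (flipped-partner x∈))
      where
      others : ∀ j → j ≢ proj₁ (path-partner x∈) → 𝟙 (flipped x j) ≡ 0
      others j j≢ with flipped x j in flip
      ... | true = ⊥-elim (j≢ (flipped-on-path x∈ j flip))
      ... | false = refl

    degree-S-at-end : ∀ {x} → x ∈ p → Stuck (not b) x → degree S x ≡ 0
    degree-S-at-end {x} x∈ stuck with path-partner x∈
    ... | (a , _ , da) = degree≡0 S absent
      where
      absent : ∀ j → S x j ≡ false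
      absent j with S x j in Txj | side b x j in on-b
      ... | false | _ = refl
      ... | true | true = ⊥-elim (true≢false (trans (sym Txj) (trans (cong (S x) (S-shared-edge da Txj on-b)) (off-side da))))
      ... | true | false = ⊥-elim (stuck j (S⇒Diff Txj on-b))

    h≢t : h ≢ t
    h≢t e = head∉tail un (subst (_∈ w ∷ r) (sym e) (lastFrom∈ w r))

    δ : V → V → ℕ
    δ x y = 𝟙 (does (x ≟ᶠ y))

    ∑-δ : ∀ y → ∑ (λ x → δ x y) ≡ 1
    ∑-δ y = trans (∑-concentrated y (λ x → δ x y) (λ x x≢y → cong 𝟙 (dec-false (x ≟ᶠ y) x≢y))) (cong 𝟙 (dec-true (y ≟ᶠ y) refl))

    degree-flipped : ∀ x → degree flipped x ≡ degree S x + δ x h + δ x t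
    degree-flipped x = by-cases (x ≟ᶠ h) (x ≟ᶠ t)
      where
      by-cases : (x≟h : Dec (x ≡ h)) (x≟t : Dec (x ≡ t)) → degree flipped x ≡ degree S x + 𝟙 (does x≟h) + 𝟙 (does x≟t)
      by-cases (yes refl) (yes x≡t) = ⊥-elim (h≢t x≡t)
      by-cases (yes refl) (no _) =
        trans (degree-flipped-on-path (here refl)) (cong (λ z → z + 1 + 0) (sym (degree-S-at-end (here refl) stuck-head)))
      by-cases (no _) (yes refl) =
        trans (degree-flipped-on-path (there (lastFrom∈ w r))) (cong (λ z → z + 0 + 1) (sym (degree-S-at-end (there (lastFrom∈ w r)) stuck-last)))
      by-cases (no x≢h) (no x≢t) with x ∈? p
      ... | no x∉ = trans (sum-cong-≗ (λ j → cong 𝟙 (flipped-off-path x∉ j))) (sym (trans (+-identityʳ _) (+-identityʳ _)))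
      ... | yes x∈ with position h (w ∷ r) al x∈
      ...   | inj₁ x≡h = ⊥-elim (x≢h x≡h)
      ...   | inj₂ (inj₁ x≡t) = ⊥-elim (x≢t x≡t)
      ...   | inj₂ (inj₂ int) =
        let (c , _ , dc) = int (not b) in
        trans (degree-flipped-on-path x∈) (sym (trans (+-identityʳ _) (trans (+-identityʳ _) (degree≡1 S-matching (on-side dc)))))

    flipped-matching : IsMatchingSet flipped
    flipped-matching = record { symmetric = sym′ ; loopless = loopless′ ; functional = functional′ }
      where
      sym′ : ∀ i j → flipped i j ≡ flipped j i
      sym′ i j = cong₂ _xor_ (symmetric S-matching i j) (does-⇔ (mk⇔ OnPath-sym OnPath-sym) (OnPath? i j p) (OnPath? j i p))
      loopless′ : ∀ i → flipped i i ≡ false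
      loopless′ i with OnPath? i i p
      ... | yes on = ⊥-elim ([ Diff-irrefl , Diff-irrefl ]′ (OnPath-Diff b p al on))
      ... | no _ rewrite loopless S-matching i = refl
      functional′ : ∀ x j k → flipped x j ≡ true → flipped x k ≡ true → j ≡ k
      functional′ x j k fj fk with x ∈? p
      ... | yes x∈ = trans (flipped-on-path x∈ j fj) (sym (flipped-on-path x∈ k fk))
      ... | no x∉ = functional S-matching x j k (trans (sym (flipped-off-path x∉ j)) fj) (trans (sym (flipped-off-path x∉ k)) fk)

    flipped⊆ : ∀ i j → flipped i j ≡ true → S i j ≡ true ⊎ Diff b i j
    flipped⊆ i j fij with OnPath? i j p
    ... | no _ = inj₁ (trans (sym (xor-identityʳ (S i j))) fij)
    ... | yes on with OnPath-Diff b p {i} {j} al on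
    ...   | inj₁ d = inj₂ d
    ...   | inj₂ d = inj₁ (on-side d)

    size-flipped : size flipped ≡ suc (size S)
    size-flipped = double-injective (begin
      size flipped + size flipped
        ≡⟨ sym (handshake flipped-matching) ⟩
      ∑ (degree flipped)
        ≡⟨ sum-cong-≗ degree-flipped ⟩
      ∑ (λ x → degree S x + δ x h + δ x t)
        ≡⟨ ∑-distrib-+ (λ x → degree S x + δ x h) (λ x → δ x t) ⟩
      ∑ (λ x → degree S x + δ x h) + ∑ (λ x → δ x t)
        ≡⟨ cong₂ _+_ (∑-distrib-+ (degree S) (λ x → δ x h)) (∑-δ t) ⟩
      ∑ (degree S) + ∑ (λ x → δ x h) + 1
        ≡⟨ cong (λ z → ∑ (degree S) + z + 1) (∑-δ h) ⟩
      ∑ (degree S) + 1 + 1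
        ≡⟨ cong (λ z → z + 1 + 1) (handshake S-matching) ⟩
      size S + size S + 1 + 1
        ≡⟨ arith (size S) ⟩
      suc (size S) + suc (size S) ∎)
      where
      open ≡-Reasoning
      arith : ∀ a → a + a + 1 + 1 ≡ suc a + suc a
      arith = solve-∀

  augment : ∀ b v → OddEnd b v → ∃ λ (Z : EdgeSet n) → IsMatchingSet Z ×
    (∀ i j → Z i j ≡ true → side (not b) i j ≡ true ⊎ Diff b i j) × size Z ≡ suc (size (side (not b)))
  augment b v ((d , stuck) , odd) with trail b v | WalkSpec.unique (trail-spec b v) | WalkSpec.alternating (trail-spec b v)
                                     | trail-ends-stuck b v stuck | trail-nonempty b v (d , stuck)
  ... | w ∷ r | un | al | stuck-last | _ =
    let module A = Augmentation b v w r un al stuck (subst (λ c → Stuck c (lastFrom w r)) odd stuck-last) odd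
    in A.flipped , A.flipped-matching , A.flipped⊆ , A.size-flipped

  OddMaxPath-shape : ∀ b q → OddMaxPath b q →
    ∃ λ h → ∃₂ λ w r → q ≡ h ∷ w ∷ r × trail b h ≡ w ∷ r × OddEnd b h
  OddMaxPath-shape b q (max , al , odd , _) with OddMaxPath⇒pathFrom b q max al odd
  ... | (h , refl , oddEnd) with trail-nonempty b h (proj₁ oddEnd)
  ...   | (w , r , trail≡) = h , w , r , cong (h ∷_) trail≡ , trail≡ , oddEnd

  OddMaxPath-partner : ∀ b q {v} → OddMaxPath b q → v ∈ q → ∃ λ a → OnPath v a q × Diff b v a
  OddMaxPath-partner b q oq@(_ , al , _) v∈ with OddMaxPath-shape b q oq
  ... | (h , w , r , refl , trail≡ , (_ , odd)) =
    odd-path-partner b h w r al (subst (λ z → nextSide b (h ∷ z) ≡ not b) trail≡ odd) v∈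

  OddMaxPath-vertex : ∀ b q {v} → OddMaxPath b q → v ∈ q → OddEnd b v ⊎ (∃ λ c → OnPath v c q × Diff (not b) v c)
  OddMaxPath-vertex b q oq@(_ , al , _) v∈ with OddMaxPath-shape b q oq
  ... | (h , w , r , refl , trail≡ , oddEnd) with position h (w ∷ r) al v∈
  ...   | inj₁ refl = inj₁ oddEnd
  ...   | inj₂ (inj₂ int) = inj₂ (int (not b))
  ...   | inj₂ (inj₁ refl) =
    inj₁ (subst (OddEnd b) (trans (opposite-Endpoint b h (proj₁ oddEnd)) (cong (lastFrom h) trail≡)) (OddEnd-opposite b h oddEnd))

  OddEnd⇒on-OddMaxPath : ∀ b v → OddEnd b v → ∃₂ λ a q → OddMaxPath b q × OnPath v a q × Diff b v a
  OddEnd⇒on-OddMaxPath b v oddEnd with <-cmp (toℕ v) (toℕ (far b v))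
  ... | tri< v<far _ _ =
    let oq = OddEnd⇒OddMaxPath b v oddEnd v<far
        (a , on , da) = OddMaxPath-partner b (pathFrom b v) oq (here refl)
    in a , pathFrom b v , oq , on , da
  ... | tri≈ _ v≡far _ = ⊥-elim (opposite-moves b v (proj₁ oddEnd) (sym (trans (toℕ-injective v≡far) (sym (opposite-Endpoint b v (proj₁ oddEnd))))))
  ... | tri> _ _ far<v =
    let u = opposite v
        u≡far = opposite-Endpoint b v (proj₁ oddEnd)
        oddEnd-u = OddEnd-opposite b v oddEnd
        far-u≡v = trans (sym (opposite-Endpoint b u (proj₁ oddEnd-u))) (opposite-involutive v)
        oq = OddEnd⇒OddMaxPath b u oddEnd-u (subst₂ (λ x y → toℕ x < toℕ y) (sym u≡far) (sym far-u≡v) far<v)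
        v∈ = subst (_∈ pathFrom b u) far-u≡v (lastFrom∈ u (trail b u))
        (a , on , da) = OddMaxPath-partner b (pathFrom b u) oq v∈
    in a , pathFrom b u , oq , on , da

IsLambda2-unique : ∀ {n} {G : SimpleGraph n} {l l'} → IsLambda2 G l → IsLambda2 G l' → l ≡ l'
IsLambda2-unique ((H , H' , b2 , sum≡l) , ≤l) ((K , K' , b2' , sum≡l') , ≤l') =
  ≤-antisym (subst (_≤ _) sum≡l (≤l' H H' b2)) (subst (_≤ _) sum≡l' (≤l K K' b2'))

IsAlpha2-unique : ∀ {n} {G : SimpleGraph n} {a a'} → IsAlpha2 G a → IsAlpha2 G a' → a ≡ a'
IsAlpha2-unique {G = G} (l , isλ , (H , H' , b2 , sum≡ , attained) , ≤a) (l' , isλ' , (K , K' , b2' , sum≡' , attained') , ≤a') =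
  ≤-antisym (bound attained (≤a' H H' b2 (trans sum≡ l≡l'))) (bound attained' (≤a K K' b2' (trans sum≡' (sym l≡l'))))
  where
  l≡l' = IsLambda2-unique {G = G} isλ isλ'
  bound : ∀ {x y z w} → x ≡ z ⊎ y ≡ z → x ≤ w × y ≤ w → z ≤ w
  bound (inj₁ refl) (x≤ , _) = x≤
  bound (inj₂ refl) (_ , y≤) = y≤

IsMaxMatching⇒IsNu : ∀ {n} {G : SimpleGraph n} {M ν} → IsMaxMatching G M → IsNu G ν → size M ≡ ν
IsMaxMatching⇒IsNu (mM , maxM) (M' , (mM' , maxM') , size≡ν) =
  ≤-antisym (subst (_ ≤_) size≡ν (maxM' _ mM)) (subst (_≤ _) size≡ν (maxM _ mM'))

halve-≤ : ∀ {a b} → a + a ≤ b + b → a ≤ b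
halve-≤ a+a≤b+b = ≮⇒≥ λ b<a → <⇒≱ (+-mono-< b<a b<a) a+a≤b+b

counting-arithmetic : ∀ {h m x y z k e} → h + h + e ≡ m + m → x + x ≡ y + y + e → z + z ≡ x + x + (k + k) →
  z ≡ k + y + (m ∸ h)
counting-arithmetic {h} {m} {x} {y} {z} {k} {e} H-vs-M MA-vs-HA H'-vs-MA = double-injective (begin
  z + z                              ≡⟨ H'-vs-MA ⟩
  x + x + (k + k)                    ≡⟨ cong (_+ (k + k)) MA-vs-HA ⟩
  y + y + e + (k + k)                ≡⟨ cong (λ e → y + y + e + (k + k)) e≡d+d ⟩
  y + y + (d + d) + (k + k)          ≡⟨ regroup y d k ⟩
  (k + y + d) + (k + y + d)          ∎)
  where
  open ≡-Reasoning
  d = m ∸ h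
  h≤m : h ≤ m
  h≤m = halve-≤ (≤-trans (m≤m+n (h + h) e) (≤-reflexive H-vs-M))
  regroup : ∀ y d k → y + y + (d + d) + (k + k) ≡ (k + y + d) + (k + y + d)
  regroup = solve-∀
  spread : ∀ h d → (h + d) + (h + d) ≡ h + h + (d + d)
  spread = solve-∀
  e≡d+d : e ≡ d + d
  e≡d+d = +-cancelˡ-≡ (h + h) e (d + d)
    (trans H-vs-M (trans (cong (λ m → m + m) (sym (m+[n∸m]≡n h≤m))) (spread h d)))

module StandingSetting {n : ℕ} (G : SimpleGraph n) (H H' M MA HA : EdgeSet n)
  (standing : Standing G H H' M) (isMA : IsMA M H MA) (isHA : IsHA M H HA) where

  open IsMatchingSet

  B2-HH' : B2 G H H'
  B2-HH' = proj₁ (proj₁ standing)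

  isλ : IsLambda2 G (size H + size H')
  isλ = proj₁ (proj₂ (proj₁ standing))

  isα : IsAlpha2 G (size H)
  isα = proj₂ (proj₂ (proj₁ standing))

  M-maximum : IsMaxMatching G M
  M-maximum = proj₁ (proj₂ standing)

  H-matching : IsMatchingSet H
  H-matching = IsMatching⇒IsMatchingSet {G = G} (proj₁ B2-HH')

  H'-matching : IsMatchingSet H'
  H'-matching = IsMatching⇒IsMatchingSet {G = G} (proj₁ (proj₂ B2-HH'))

  M-matching : IsMatchingSet M
  M-matching = IsMatching⇒IsMatchingSet {G = G} (proj₁ M-maximum)

  MA⊆M : ∀ {i j} → MA i j ≡ true → M i j ≡ true
  MA⊆M {i} {j} e = proj₁ (proj₁ (isMA i j) e)

  HA⊆H : ∀ {i j} → HA i j ≡ true → H i j ≡ true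
  HA⊆H {i} {j} e = proj₁ (proj₁ (isHA i j) e)

  module MH = Alternation M-matching H-matching

  MA-matching : IsMatchingSet MA
  MA-matching = record
    { symmetric = λ i j → ⇔→≡ (mk⇔ (flip i j) (flip j i))
    ; loopless = λ i → ¬-not (λ e → true≢false (trans (sym (MA⊆M e)) (loopless M-matching i)))
    ; functional = λ i j k e e' → functional M-matching i j k (MA⊆M e) (MA⊆M e')
    }
    where
    flip : ∀ i j → MA i j ≡ true → MA j i ≡ true
    flip i j e = let (Mij , q , oq , on) = proj₁ (isMA i j) e in
      proj₂ (isMA j i) (trans (symmetric M-matching j i) Mij , q , oq , OnPath-sym on)

  HA-matching : IsMatchingSet HA
  HA-matching = record
    { symmetric = λ i j → ⇔→≡ (mk⇔ (flip i j) (flip j i))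
    ; loopless = λ i → ¬-not (λ e → true≢false (trans (sym (HA⊆H e)) (loopless H-matching i)))
    ; functional = λ i j k e e' → functional H-matching i j k (HA⊆H e) (HA⊆H e')
    }
    where
    flip : ∀ i j → HA i j ≡ true → HA j i ≡ true
    flip i j e = let (Hij , q , oq , on) = proj₁ (isHA i j) e in
      proj₂ (isHA j i) (trans (symmetric H-matching j i) Hij , q , oq , OnPath-sym on)

  module MAH' = Alternation MA-matching H'-matching

  MA-disjoint-H : ∀ {i j} → MA i j ≡ true → H i j ≡ true → ⊥
  MA-disjoint-H {i} {j} e Hij with proj₁ (isMA i j) e
  ... | (Mij , q , (_ , al , _) , on) with MH.OnPath-Diff true q al on
  ...   | inj₁ d = true≢false (trans (sym Hij) (MH.off-side d))
  ...   | inj₂ d = true≢false (trans (sym Mij) (MH.off-side d))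

  -- An odd MA-H' path with both end edges in MA would give a matching disjoint from H larger than H'.
  no-OddEnd-MA : ∀ v → ¬ MAH'.OddEnd true v
  no-OddEnd-MA v oddEnd with MAH'.augment true v oddEnd
  ... | (Z , Z-matching , Z⊆ , size≡) =
    <-irrefl refl (≤-trans (subst (λ z → size H + size H' < size H + z) (sym size≡) (+-monoʳ-< (size H) ≤-refl))
                           (proj₂ isλ H Z (proj₁ B2-HH' , Z-IsMatching , H-disjoint-Z)))
    where
    Z⊆G : ∀ i j → Z i j ≡ true → adj G i j ≡ true
    Z⊆G i j z with Z⊆ i j z
    ... | inj₁ H'ij = proj₂ (proj₁ (proj₁ (proj₂ B2-HH'))) i j H'ij
    ... | inj₂ d = proj₂ (proj₁ (proj₁ M-maximum)) i j (MA⊆M (MAH'.on-side d))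
    Z-IsMatching : IsMatching G Z
    Z-IsMatching = (symmetric Z-matching , Z⊆G) , functional Z-matching
    H-disjoint-Z : EdgeDisjoint H Z
    H-disjoint-Z i j Hij = ¬-not λ z → case (Z⊆ i j z)
      where
      case : H' i j ≡ true ⊎ MAH'.Diff true i j → ⊥
      case (inj₁ H'ij) = true≢false (trans (sym H'ij) (proj₂ (proj₂ B2-HH') i j Hij))
      case (inj₂ d) = MA-disjoint-H (MAH'.on-side d) Hij

  -- An odd M-H path with both end edges in H would augment M.
  no-OddEnd-H : ∀ v → ¬ MH.OddEnd false v
  no-OddEnd-H v oddEnd with MH.augment false v oddEnd
  ... | (Z , Z-matching , Z⊆ , size≡) =
    <-irrefl refl (≤-trans (subst (size M <_) (sym size≡) ≤-refl) (proj₂ M-maximum Z Z-IsMatching))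
    where
    Z⊆G : ∀ i j → Z i j ≡ true → adj G i j ≡ true
    Z⊆G i j z with Z⊆ i j z
    ... | inj₁ Mij = proj₂ (proj₁ (proj₁ M-maximum)) i j Mij
    ... | inj₂ d = proj₂ (proj₁ (proj₁ B2-HH')) i j (MH.on-side d)
    Z-IsMatching : IsMatching G Z
    Z-IsMatching = (symmetric Z-matching , Z⊆G) , functional Z-matching

  covered-MA⇔ : ∀ v → Covered MA v ⇔ (Covered HA v ⊎ MH.OddEnd true v)
  covered-MA⇔ v = mk⇔ to from
    where
    to : Covered MA v → Covered HA v ⊎ MH.OddEnd true v
    to (j , e) with proj₁ (isMA v j) e
    ... | (_ , q , oq , on) with MH.OddMaxPath-vertex true q oq (proj₁ (OnPath-endpoints q on))
    ...   | inj₁ oddEnd = inj₂ oddEnd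
    ...   | inj₂ (c , on-c , d) = inj₁ (c , proj₂ (isHA v c) (MH.on-side d , q , oq , on-c))
    from : Covered HA v ⊎ MH.OddEnd true v → Covered MA v
    from (inj₁ (j , e)) =
      let (_ , q , oq , on) = proj₁ (isHA v j) e
          (a , on-a , d) = MH.OddMaxPath-partner true q oq (proj₁ (OnPath-endpoints q on))
      in a , proj₂ (isMA v a) (MH.on-side d , q , oq , on-a)
    from (inj₂ oddEnd) =
      let (a , q , oq , on-a , d) = MH.OddEnd⇒on-OddMaxPath true v oddEnd
      in a , proj₂ (isMA v a) (MH.on-side d , q , oq , on-a)

  covered-HA-not-OddEnd : ∀ v → Covered HA v → ¬ MH.OddEnd true v
  covered-HA-not-OddEnd v (j , e) ((_ , stuck) , _) with proj₁ (isHA v j) e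
  ... | (Hvj , q , (_ , al , _) , on) with MH.OnPath-Diff true q al on
  ...   | inj₁ d = true≢false (trans (sym Hvj) (MH.off-side d))
  ...   | inj₂ d = stuck j d

  degree-MA : ∀ v → degree MA v ≡ degree HA v + 𝟙 (does (MH.OddEnd? true v))
  degree-MA v = begin
    degree MA v
      ≡⟨ degree≡𝟙covered MA-matching v ⟩
    𝟙 (does (covered? MA v))
      ≡⟨ cong 𝟙 (does-⇔ (covered-MA⇔ v) (covered? MA v) (covered? HA v ⊎-dec MH.OddEnd? true v)) ⟩
    𝟙 (does (covered? HA v) ∨ does (MH.OddEnd? true v))
      ≡⟨ 𝟙-∨ (covered? HA v) (MH.OddEnd? true v) (covered-HA-not-OddEnd v) ⟩
    𝟙 (does (covered? HA v)) + 𝟙 (does (MH.OddEnd? true v))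
      ≡⟨ cong (_+ 𝟙 (does (MH.OddEnd? true v))) (sym (degree≡𝟙covered HA-matching v)) ⟩
    degree HA v + 𝟙 (does (MH.OddEnd? true v)) ∎
    where open ≡-Reasoning

  size-H'-identity : size H' + size H' ≡ size MA + size MA + (# (MAH'.canonical false) + # (MAH'.canonical false))
  size-H'-identity = begin
    size H' + size H'
      ≡⟨ sym (+-identityʳ _) ⟩
    size H' + size H' + 0
      ≡⟨ cong (size H' + size H' +_) (sym (#-none (MAH'.OddEnd? true) no-OddEnd-MA)) ⟩
    size H' + size H' + # (does ∘ MAH'.OddEnd? true)
      ≡⟨ MAH'.count-balance ⟩
    size MA + size MA + # (does ∘ MAH'.OddEnd? false)
      ≡⟨ cong (size MA + size MA +_) (MAH'.#oddEnds≡2#canonical false) ⟩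
    size MA + size MA + (# (MAH'.canonical false) + # (MAH'.canonical false)) ∎
    where open ≡-Reasoning

  size-H-identity : size H + size H + # (does ∘ MH.OddEnd? true) ≡ size M + size M
  size-H-identity = trans MH.count-balance
    (trans (cong (size M + size M +_) (#-none (MH.OddEnd? false) no-OddEnd-H)) (+-identityʳ _))

  size-MA-identity : size MA + size MA ≡ size HA + size HA + # (does ∘ MH.OddEnd? true)
  size-MA-identity = begin
    size MA + size MA
      ≡⟨ sym (handshake MA-matching) ⟩
    ∑ (degree MA)
      ≡⟨ sum-cong-≗ degree-MA ⟩
    ∑ (λ v → degree HA v + 𝟙 (does (MH.OddEnd? true v)))
      ≡⟨ ∑-distrib-+ (degree HA) (𝟙 ∘ does ∘ MH.OddEnd? true) ⟩
    ∑ (degree HA) + # (does ∘ MH.OddEnd? true)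
      ≡⟨ cong (_+ # (does ∘ MH.OddEnd? true)) (handshake HA-matching) ⟩
    size HA + size HA + # (does ∘ MH.OddEnd? true) ∎
    where open ≡-Reasoning

lemma4 : ∀ {n} (G : SimpleGraph n) (H H' M MA HA : EdgeSet n) →
    Standing G H H' M → IsMA M H MA → IsHA M H HA →
    (ν α : ℕ) → IsNu G ν → IsAlpha2 G α →
    ∃ λ k → Card (PoB MA H') k × size H' ≡ k + size HA + (ν ∸ α)
lemma4 G H H' M MA HA standing isMA isHA ν α isν isα′ =
  k , MAH'.card-OddMaxPath false ,
  subst₂ (λ m a → size H' ≡ k + size HA + (m ∸ a))
    (IsMaxMatching⇒IsNu {G = G} M-maximum isν) (IsAlpha2-unique {G = G} isα isα′)
    (counting-arithmetic {size H} {size M} {size MA} {size HA} {size H'} {k} {# (does ∘ MH.OddEnd? true)}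
       size-H-identity size-MA-identity size-H'-identity)
  where
  open StandingSetting G H H' M MA HA standing isMA isHA
  k = # (MAH'.canonical false)
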